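{- Consider the Derandomized Random Greedy algorithm described in the context, run on a non-negative submodular $f$ on ground set $N$ and a matroid $\mathcal{M}=(N,\mathcal{I})$ of rank $k$, and let $O\in\arg\max\{f(S):S\in\mathcal{I}\}$. For every iteration $i=1,2,\dots,k$, \[ \mathbb{E}_{S\sim\mathcal{D}_i}[f(S)]\ \ge\ \left(1-\frac2k\right)\mathbb{E}_{S\sim\mathcal{D}_{i-1}}[f(S)]+\frac{1+(1-2/k)^{i-1}}{2k}\, f(O). \]
   Context: Notation: $f(u\mid S)=f(S\cup\{u\})-f(S)$, $S+u=S\cup\{u\}$, $S-u=S\setminus\{u\}$. Dummy elements: starting from an original instance $(N_0,f_0,\mathcal{M}_0)$ of rank $k$, one adds a set $D$ of $2k$ dummy elements and works with $N=N_0\cup D$, $f(S)=f_0(S\setminus D)$, and $\mathcal{I}=\{S\subseteq N: S\setminus D\in\mathcal{I}_0,\ |S|\le k\}$. Exchange property: for any two bases $A,B$ there is a one-to-one map $g:A\to B$ with $g(u)=u$ for $u\in A\cap B$ and $B\cup\{u\}\setminus\{g(u)\}\in\mathcal{I}$ for all $u\in A$. A distribution $\mathcal{D}$ is represented by a multiset of pairs $(p_j,S_j)$ with $p_j\ge0$; $\mathrm{supp}(\mathcal{D})$ is the set of distinct $S_j$ and $\Pr_{\mathcal{D}}[S]$ the total probability of pairs with set $S$. Algorithm: Let $\mathcal{D}_0=\{(1,S)\}$ where $S$ is a base consisting only of dummy elements. For $i=1,\dots,k$: (a) let $M_i$ be a base maximizing $\sum_{u\in M_i}\mathbb{E}_{S\sim\mathcal{D}_{i-1}}[f(u\mid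 S)]$; (b) for every $S\in\mathrm{supp}(\mathcal{D}_{i-1})$ let $g_{i,S}:M_i\to S$ be a map as in the exchange property with $A=M_i,B=S$; (c) find an extreme-point solution $x$ (variables $x(u,S)$, $u\in M_i$, $S\in\mathrm{supp}(\mathcal{D}_{i-1})$) of the system (P): $\sum_{u\in M_i}\mathbb{E}_{S\sim\mathcal{D}_{i-1}}[x(u,S) f(u\mid S)]\ge \frac1k\sum_{u\in M_i}\mathbb{E}_{S\sim\mathcal{D}_{i-1}}[f(u\mid S)]$; $\sum_{u\in M_i}\mathbb{E}_{S\sim\mathcal{D}_{i-1}}[x(u,S) f(g_{i,S}(u)\mid S\setminus\{g_{i,S}(u)\})]\le \frac1k\sum_{u\in M_i}\mathbb{E}_{S\sim\mathcal{D}_{i-1}}[f(g_{i,S}(u)\mid S\setminus\{g_{i,S}(u)\})]$; $\mathbb{E}_{S\sim\mathcal{D}_{i-1}}[x(u,S)\mathbf{1}[u\notin S]]\le \frac1k\Pr_{S\sim\mathcal{D}_{i-1}}[u\notin S]$ for all $u\in M_i$; $\mathbb{E}_{S\sim\mathcal{D}_{i-1}}[x(g_{i,S}^{ -1}(u),S)\mathbf{1}[u\in S]]\ge \frac1k\Pr_{S\sim\mathcal{D}_{i-1}}[u\in S]$ for all $u\in N$; $\sum_{u\in M_i}x(u,S)=1$ for all $S\in\mathrm{supp}(\mathcal{D}_{i-1})$; $x(u,S)\ge0$; (d) set $\mathcal{D}_i=\{(x(u,S)\Pr_{\mathcal{D}_{i-1}}[S],\ S+u-g_{i,S}(u)) :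 u\in M_i, S\in\mathrm{supp}(\mathcal{D}_{i-1}), x(u,S)>0\}$. Output $\arg\max_{S\in\mathrm{supp}(\mathcal{D}_k)}f(S)$.
   Formalization: The values of $f_0$ (hence of $f$), the probabilities $p_j$ and the solutions $x$ of (P) are rational rather than real. -}

module Defs where

open import Data.Nat as ℕ using (ℕ; zero; suc)
open import Data.Fin using (Fin)
open import Data.Fin.Subset using (Subset; _∈_; _∉_; _⊆_; _∪_; _∩_; ⁅_⁆; ∣_∣; ⊥)
open import Data.Fin.Subset using () renaming (_-_ to _∖_)
open import Data.Fin.Subset.Properties using (_∈?_)
open import Data.Vec using (take)
open import Data.Vec.Properties using (≡-dec)
open import Data.Bool using (if_then_else_) renaming (_≟_ to _≟ᵇ_)
open import Data.List using (List; []; _∷_; map; filter; foldr; allFin; concatMap; deduplicate)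
open import Data.List.Relation.Unary.Any using (Any)
open import Data.Integer using (+_)
open import Data.Rational using (ℚ; 0ℚ; 1ℚ; _+_; _*_; _-_; _≤_; _<_; _/_)
open import Data.Rational.Properties using (_<?_)
open import Data.Product using (Σ; ∃; _×_; _,_; proj₁; proj₂)
open import Relation.Binary.PropositionalEquality using (_≡_)
open import Relation.Nullary using (¬_; Dec; does)
open import Relation.Nullary.Decidable using (_×-dec_)

record Matroid (n : ℕ) : Set₁ where
  field
    Indep      : Subset n → Set
    indep-∅    : Indep ⊥
    hereditary : ∀ {A B} → A ⊆ B → Indep B → Indep A
    augment    : ∀ {A B} → Indep A → Indep B → ∣ A ∣ ℕ.< ∣ B ∣ →
                 ∃ λ x → x ∈ B × x ∉ A × Indep (A ∪ ⁅ x ⁆)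

HasRank : ∀ {n} → Matroid n → ℕ → Set
HasRank {n} M k =
  (∃ λ (S : Subset n) → Matroid.Indep M S × ∣ S ∣ ≡ k) ×
  (∀ S → Matroid.Indep M S → ∣ S ∣ ℕ.≤ k)

NonNegative : ∀ {n} → (Subset n → ℚ) → Set
NonNegative f = ∀ S → 0ℚ ≤ f S

Submodular : ∀ {n} → (Subset n → ℚ) → Set
Submodular f = ∀ A B → f (A ∪ B) + f (A ∩ B) ≤ f A + f B

sumℚ : List ℚ → ℚ
sumℚ = foldr _+_ 0ℚ

ΣIn : ∀ {m} → Subset m → (Fin m → ℚ) → ℚ
ΣIn {m} B φ = sumℚ (map φ (filter (_∈? B) (allFin m)))

-- 1/m, with the convention 1/0 = 0 (only used when m ≥ 1)
recip : ℕ → ℚ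
recip zero    = 0ℚ
recip (suc m) = + 1 / suc m

_^ℚ_ : ℚ → ℕ → ℚ
q ^ℚ zero  = 1ℚ
q ^ℚ suc j = q * (q ^ℚ j)

½ : ℚ
½ = + 1 / 2

𝟙 : ∀ {P : Set} → Dec P → ℚ
𝟙 d = if does d then 1ℚ else 0ℚ

_≟ₛ_ : ∀ {m} (A B : Subset m) → Dec (A ≡ B)
_≟ₛ_ = ≡-dec _≟ᵇ_

-- Distributions: multisets of pairs (p_j , S_j), represented as lists.
Dist : ℕ → Set
Dist m = List (ℚ × Subset m)

𝔼 : ∀ {m} → Dist m → (Subset m → ℚ) → ℚ
𝔼 D φ = sumℚ (map (λ q → proj₁ q * φ (proj₂ q)) D)

PrSet : ∀ {m} → Dist m → Subset m → ℚ
PrSet D S = sumℚ (map proj₁ (filter (λ q → proj₂ q ≟ₛ S) D))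

supp : ∀ {m} → Dist m → List (Subset m)
supp D = deduplicate _≟ₛ_ (map proj₂ D)

InSupp : ∀ {m} → Dist m → Subset m → Set
InSupp D S = Any (λ q → proj₂ q ≡ S) D

-- The algorithm, on the dummy-augmented instance built from
-- (Fin n, f₀, I₀) of rank k.  Ground set N = Fin (n + 2k); the elements
-- n, …, n+2k-1 are the dummies; S \ D corresponds to `take n S`.

module Alg (n k : ℕ) (f₀ : Subset n → ℚ) (I₀ : Subset n → Set) where

  N : ℕ
  N = n ℕ.+ (k ℕ.+ k)

  f : Subset N → ℚ
  f S = f₀ (take n S)

  I : Subset N → Set
  I S = I₀ (take n S) × ∣ S ∣ ℕ.≤ k

  Base : Subset N → Set
  Base S = I S × (∀ x → x ∉ S → ¬ I (S ∪ ⁅ x ⁆))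

  DummyOnly : Subset N → Set
  DummyOnly S = take n S ≡ ⊥

  marg : Fin N → Subset N → ℚ
  marg u S = f (S ∪ ⁅ u ⁆) - f S

  margOut : Fin N → Subset N → ℚ
  margOut v S = f S - f (S ∖ v)

  κ : ℚ
  κ = recip k

  MaxBase : Dist N → Subset N → Set
  MaxBase D M = Base M ×
    (∀ B → Base B → ΣIn B (λ u → 𝔼 D (marg u)) ≤ ΣIn M (λ u → 𝔼 D (marg u)))

  Exchange : Subset N → Subset N → (Fin N → Fin N) → Set
  Exchange M S g =
    (∀ u → u ∈ M → g u ∈ S) ×
    (∀ u v → u ∈ M → v ∈ M → g u ≡ g v → u ≡ v) ×
    (∀ u → u ∈ M → u ∈ S → g u ≡ u) ×
    (∀ u → u ∈ M → I ((S ∪ ⁅ u ⁆) ∖ g u))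

  -- x(g_S^{-1}(u), S): the sum of x(v,S) over the (at most one) v ∈ M with g_S(v) = u
  xInv : Subset N → (Subset N → Fin N → Fin N) → (Fin N → Subset N → ℚ) →
         Fin N → Subset N → ℚ
  xInv M g x u S = ΣIn M (λ v → 𝟙 (g S v Data.Fin.≟ u) * x v S)

  -- (c) the system (P); g S is g_{i,S}, x u S is x(u,S)
  Feasible : Dist N → Subset N → (Subset N → Fin N → Fin N) →
             (Fin N → Subset N → ℚ) → Set
  Feasible D M g x =
    (κ * ΣIn M (λ u → 𝔼 D (marg u))
       ≤ ΣIn M (λ u → 𝔼 D (λ S → x u S * marg u S))) ×
    (ΣIn M (λ u → 𝔼 D (λ S → x u S * margOut (g S u) S))
       ≤ κ * ΣIn M (λ u → 𝔼 D (λ S → margOut (g S u) S))) ×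
    (∀ u → u ∈ M →
       𝔼 D (λ S → x u S * 𝟙 (Relation.Nullary.¬? (u ∈? S)))
         ≤ κ * 𝔼 D (λ S → 𝟙 (Relation.Nullary.¬? (u ∈? S)))) ×
    (∀ u →
       κ * 𝔼 D (λ S → 𝟙 (u ∈? S))
         ≤ 𝔼 D (λ S → xInv M g x u S * 𝟙 (u ∈? S))) ×
    (∀ S → InSupp D S → ΣIn M (λ u → x u S) ≡ 1ℚ) ×
    (∀ u S → u ∈ M → InSupp D S → 0ℚ ≤ x u S)

  Extreme : Dist N → Subset N → (Subset N → Fin N → Fin N) →
            (Fin N → Subset N → ℚ) → Set
  Extreme D M g x =
    Feasible D M g x ×
    (∀ y z → Feasible D M g y → Feasible D M g z →
      (∀ u S → u ∈ M → InSupp D S → x u S ≡ ½ * (y u S + z u S)) →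
      ∀ u S → u ∈ M → InSupp D S → y u S ≡ z u S)

  nextDist : Dist N → Subset N → (Subset N → Fin N → Fin N) →
             (Fin N → Subset N → ℚ) → Dist N
  nextDist D M g x =
    concatMap
      (λ S → map (λ u → (x u S * PrSet D S , (S ∪ ⁅ u ⁆) ∖ g S u))
                 (filter (λ u → (u ∈? M) ×-dec (0ℚ <? x u S)) (allFin N)))
      (supp D)

  Run : (ℕ → Dist N) → Set
  Run D =
    (∃ λ S₀ → Base S₀ × DummyOnly S₀ × D 0 ≡ (1ℚ , S₀) ∷ []) ×
    (∀ j → j ℕ.< k →
      ∃ λ M → ∃ λ (g : Subset N → Fin N → Fin N) → ∃ λ (x : Fin N → Subset N → ℚ) →
        MaxBase (D j) M ×
        (∀ S → InSupp (D j) S → Exchange M S (g S)) ×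
        Extreme (D j) M g x ×
        D (suc j) ≡ nextDist (D j) M g x)

{-# OPTIONS --safe #-}
-- Each S in the support of D_{i-1} becomes S + u - g_S(u) with probability x(u,S).  By
-- submodularity such a swap changes f by at least f(u | S) - f(g_S(u) | S - g_S(u)), so the first two
-- constraints of (P) make E f grow by at least 1/k times the difference of the two marginal sums.
-- The removal marginals of the k elements of S sum to at most f(S).  The addition marginals over M
-- dominate those over O padded with dummies (M is a maximizing base), and these are at least
-- E f(S ∪ O) - E f(S).  The last two constraints of (P) keep the probability of each original element
-- in S ∼ D_i below q_i = (1 - (1-2/k)^i)/2, so the sampling lemma gives E f(S ∪ O) ≥ (1 - q_{i-1}) f(O).
module Submission where

open import Defs
open import Data.Bool using (Bool; true; false; _∧_; _∨_; not; if_then_else_)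
open import Data.Empty using (⊥-elim)
open import Data.Fin as Fin using (Fin; zero; suc; _↑ˡ_; _↑ʳ_)
open import Data.Fin.Properties using (¬∀⟶∃¬)
open import Data.Fin.Subset using (Subset; _∈_; _∉_; _⊆_; _∪_; _∩_; _─_; ⁅_⁆; ∣_∣; ⊥; ⊤; ⋃; Nonempty)
open import Data.Fin.Subset.Properties
  using (_∈?_; ∉⊥; x∈⁅x⁆; x∈⁅y⁆⇒x≡y; x∈p∪q⁺; x∈p∪q⁻; ⊆-antisym; ∣⊤∣≡n; ∣⊥∣≡0; p⊆q⇒∣p∣≤∣q∣; p⊂q⇒∣p∣<∣q∣;
         x∈p⇒∣p-x∣<∣p∣; p─q⊆p; ∣p∣≤n; nonempty?; Empty-unique;
         ∪-comm; ∪-identityˡ; ∪-identityʳ; ∩-identityʳ; ∩-zeroʳ)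
open import Data.List using (List; []; _∷_; _++_; map; filter; allFin; concatMap; length)
open import Data.List.Properties using (length-map)
open import Data.List.Relation.Unary.All as All using (All; []; _∷_)
import Data.List.Relation.Unary.All.Properties as All
open import Data.List.Relation.Unary.Any as Any using (here; there)
import Data.List.Relation.Unary.Any.Properties as Any
open import Data.List.Relation.Unary.AllPairs using ([]; _∷_)
open import Data.List.Relation.Unary.Unique.Propositional using (Unique)
import Data.List.Relation.Unary.Unique.Propositional.Properties as Unique
open import Data.List.Relation.Unary.Unique.DecPropositional.Properties using (deduplicate-!)
open import Data.List.Membership.Propositional using (find) renaming (_∈_ to _∈ˡ_)
open import Data.List.Membership.Propositional.Properties
  using (∈-filter⁺; ∈-filter⁻; ∈-allFin; ∈-map⁺; ∈-map⁻; ∈-concatMap⁻; ∈-deduplicate⁺; ∈-deduplicate⁻)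
open import Data.Nat as ℕ using (ℕ; zero; suc; z≤n; s≤s; _<_) renaming (_*_ to _*ℕ_)
import Data.Nat.Properties as ℕ
open import Data.Product using (∃; _×_; _,_; proj₁; proj₂; map₂)
open import Data.Sum using (inj₁; inj₂)
open import Data.Rational using (ℚ; 0ℚ; 1ℚ; _+_; _*_; _-_; -_; _≤_; nonNegative) renaming (_<_ to _<ℚ_)
open import Data.Rational.Properties
  using (_<?_; ≤-refl; ≤-trans; ≤-reflexive; +-mono-≤; +-monoˡ-≤; +-monoʳ-≤; neg-antimono-≤;
         *-monoˡ-≤-nonNeg; *-monoʳ-≤-nonNeg; nonNegative⁻¹; nonNeg*nonNeg⇒nonNeg; positive⁻¹;
         +-identityˡ; +-identityʳ; +-inverseʳ; +-assoc; *-identityˡ; *-identityʳ; *-zeroˡ; *-zeroʳ; *-comm; *-assoc;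
         *-distribˡ-+; *-distribʳ-+; neg-distrib-+)
import Data.Rational.Properties as ℚ
open import Relation.Binary.Bundles using (DecTotalOrder)
open import Data.List.Extrema (DecTotalOrder.totalOrder ℚ.≤-decTotalOrder) using (argmin; argmin-all; f[argmin]≤f[⊤]; f[argmin]≤f[xs])
import Data.Rational.Unnormalised as ℚᵘ
import Data.Rational.Unnormalised.Properties as ℚᵘ
import Data.Integer as ℤ
open import Data.Rational.Solver using (module +-*-Solver)
import Data.Vec
open import Data.Vec using ([]; _∷_; lookup; take; drop) renaming (_++_ to _++ᵥ_)
open import Data.Vec.Properties
  using (take++drop≡id; take-zipWith; lookup-zipWith; lookup-replicate; tabulate∘lookup; tabulate-cong;
         []=⇒lookup; lookup⇒[]=)
open import Function using (_∘_)
open import Relation.Binary.PropositionalEquality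
open import Relation.Nullary using (¬_; Dec; yes; no; does; ¬?)
open import Relation.Nullary.Decidable using (_×-dec_)
open import Relation.Unary using (Decidable)
open import Relation.Binary.Definitions using (DecidableEquality)

open +-*-Solver using (solve; _:=_; con; _:+_; _:*_; _:-_)

private
  variable
    m : ℕ
    A C : Set
    i : Fin m
    X Y : Subset m

0≤1 : 0ℚ ≤ 1ℚ
0≤1 = ℚ.<⇒≤ (positive⁻¹ 1ℚ)

*-nonNeg : ∀ {p q} → 0ℚ ≤ p → 0ℚ ≤ q → 0ℚ ≤ p * q
*-nonNeg {p} {q} 0≤p 0≤q =
  nonNegative⁻¹ (p * q) {{nonNeg*nonNeg⇒nonNeg p {{nonNegative 0≤p}} q {{nonNegative 0≤q}}}}

*-monoˡ-≤-≥0 : ∀ {r p q} → 0ℚ ≤ r → p ≤ q → r * p ≤ r * q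
*-monoˡ-≤-≥0 {r} 0≤r = *-monoˡ-≤-nonNeg r {{nonNegative 0≤r}}

*-monoʳ-≤-≥0 : ∀ {r p q} → 0ℚ ≤ r → p ≤ q → p * r ≤ q * r
*-monoʳ-≤-≥0 {r} 0≤r = *-monoʳ-≤-nonNeg r {{nonNegative 0≤r}}

p≤q⇒0≤q-p : ∀ {p q} → p ≤ q → 0ℚ ≤ q - p
p≤q⇒0≤q-p {p} p≤q = ≤-trans (≤-reflexive (sym (+-inverseʳ p))) (+-monoˡ-≤ (- p) p≤q)

≤-by-slack : ∀ {p q r s} → p ≤ q → r + (q - p) ≡ s → r ≤ s
≤-by-slack {p} {q} {r} p≤q eq = begin
  r            ≡⟨ sym (+-identityʳ r) ⟩
  r + 0ℚ       ≤⟨ +-monoʳ-≤ r (p≤q⇒0≤q-p p≤q) ⟩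
  r + (q - p)  ≡⟨ eq ⟩
  _            ∎
  where open ℚ.≤-Reasoning

telescope : ∀ a b c → a - c ≡ (a - b) + (b - c)
telescope = solve 3 (λ a b c → a :- c := (a :- b) :+ (b :- c)) refl

-- 𝟙 d is definitionally ι (does d).
ι : Bool → ℚ
ι b = if b then 1ℚ else 0ℚ

𝟙-nonNeg : ∀ {P : Set} (d : Dec P) → 0ℚ ≤ 𝟙 d
𝟙-nonNeg (yes _) = 0≤1
𝟙-nonNeg (no _)  = ≤-refl

𝟙-¬ : ∀ {P : Set} (d : Dec P) → 𝟙 (¬? d) ≡ 1ℚ - 𝟙 d
𝟙-¬ (yes _) = refl
𝟙-¬ (no _)  = refl

drop-zero-weight : ∀ {P Q : Set} (p? : Dec P) (q? : Dec Q) a b c → (P → ¬ Q → a ≡ 0ℚ) →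
                   𝟙 (p? ×-dec q?) * (a * b * c) ≡ b * (𝟙 p? * (a * c))
drop-zero-weight (yes _) (yes _) a b c _ =
  solve 3 (λ a b c → con 1ℚ :* (a :* b :* c) := b :* (con 1ℚ :* (a :* c))) refl a b c
drop-zero-weight (yes p) (no ¬q) a b c a≡0 rewrite a≡0 p ¬q =
  solve 2 (λ b c → con 0ℚ :* (con 0ℚ :* b :* c) := b :* (con 1ℚ :* (con 0ℚ :* c))) refl b c
drop-zero-weight (no _)  _       a b c _ =
  solve 3 (λ a b c → con 0ℚ :* (a :* b :* c) := b :* (con 0ℚ :* (a :* c))) refl a b c

0≤recip : ∀ k → 0ℚ ≤ recip k
0≤recip zero    = ≤-refl
0≤recip (suc k) = nonNegative⁻¹ (recip (suc k)) {{ℚ.normalize-nonNeg 1 (suc k)}}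

recip≤½ : ∀ k → recip (suc (suc k)) ≤ ½
recip≤½ k = ℚ.toℚᵘ-cancel-≤ (ℚᵘ.≤-respˡ-≃ (ℚᵘ.≃-sym (ℚ.toℚᵘ-fromℚᵘ (ℚᵘ.mkℚᵘ (ℤ.+ 1) (suc k))))
              (ℚᵘ.≤-respʳ-≃ (ℚᵘ.≃-sym (ℚ.toℚᵘ-fromℚᵘ (ℚᵘ.mkℚᵘ (ℤ.+ 1) 1))) (ℚᵘ.*≤* (ℤ.+≤+ (s≤s (s≤s z≤n))))))

recip-2* : ∀ k → recip (2 *ℕ suc k) ≡ ½ * recip (suc k)
recip-2* k = ℚ.toℚᵘ-injective (ℚᵘ.≃-trans (ℚ.toℚᵘ-fromℚᵘ (ℚᵘ.mkℚᵘ (ℤ.+ 1) (k ℕ.+ suc (k ℕ.+ 0))))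
  (ℚᵘ.≃-trans (ℚᵘ.*≡* refl) (ℚᵘ.≃-sym (ℚᵘ.≃-trans (ℚ.toℚᵘ-homo-* ½ (recip (suc k)))
    (ℚᵘ.*-cong (ℚ.toℚᵘ-fromℚᵘ (ℚᵘ.mkℚᵘ (ℤ.+ 1) 1)) (ℚ.toℚᵘ-fromℚᵘ (ℚᵘ.mkℚᵘ (ℤ.+ 1) k)))))))

1-2/k≤1 : ∀ k → 1ℚ - (recip k + recip k) ≤ 1ℚ
1-2/k≤1 k = ≤-by-slack (+-mono-≤ (0≤recip k) (0≤recip k))
  (solve 1 (λ κ → con 1ℚ :- (κ :+ κ) :+ ((κ :+ κ) :- con 0ℚ) := con 1ℚ) refl (recip k))

0≤1-2/k : ∀ {k} → 2 ℕ.≤ k → 0ℚ ≤ 1ℚ - (recip k + recip k)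
0≤1-2/k {suc (suc k)} (s≤s (s≤s z≤n)) = p≤q⇒0≤q-p (+-mono-≤ (recip≤½ k) (recip≤½ k))

^ℚ≤1 : ∀ {c} → 0ℚ ≤ c → c ≤ 1ℚ → ∀ j → c ^ℚ j ≤ 1ℚ
^ℚ≤1 0≤c c≤1 zero    = ≤-refl
^ℚ≤1 {c} 0≤c c≤1 (suc j) =
  ≤-trans (*-monoˡ-≤-≥0 0≤c (^ℚ≤1 0≤c c≤1 j)) (≤-trans (≤-reflexive (*-identityʳ c)) c≤1)

halved-weight : ∀ {k} → 1 ℕ.≤ k → ∀ t → (1ℚ + t) * recip (2 *ℕ k) ≡ recip k * (1ℚ - ½ * (1ℚ - t))
halved-weight {suc k} _ t = begin
  (1ℚ + t) * recip (2 *ℕ suc k)  ≡⟨ cong ((1ℚ + t) *_) (recip-2* k) ⟩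
  (1ℚ + t) * (½ * κ)              ≡⟨ solve 2 (λ κ t → (con 1ℚ :+ t) :* (con ½ :* κ) := κ :* (con 1ℚ :- con ½ :* (con 1ℚ :- t)))
                                             refl κ t ⟩
  κ * (1ℚ - ½ * (1ℚ - t))         ∎
  where
  open ≡-Reasoning
  κ : ℚ
  κ = recip (suc k)

∑ : List A → (A → ℚ) → ℚ
∑ xs φ = sumℚ (map φ xs)

∑-zero : ∀ (xs : List A) {φ} → (∀ x → x ∈ˡ xs → φ x ≡ 0ℚ) → ∑ xs φ ≡ 0ℚ
∑-zero []       h = refl
∑-zero (x ∷ xs) h rewrite h x (here refl) | ∑-zero xs (λ y y∈ → h y (there y∈)) = refl

∑-0 : ∀ (xs : List A) → ∑ xs (λ _ → 0ℚ) ≡ 0ℚ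
∑-0 xs = ∑-zero xs (λ _ _ → refl)

∑-cong : ∀ (xs : List A) {φ ψ} → (∀ x → x ∈ˡ xs → φ x ≡ ψ x) → ∑ xs φ ≡ ∑ xs ψ
∑-cong []       h = refl
∑-cong (x ∷ xs) h = cong₂ _+_ (h x (here refl)) (∑-cong xs (λ y y∈ → h y (there y∈)))

∑-mono : ∀ (xs : List A) {φ ψ} → (∀ x → x ∈ˡ xs → φ x ≤ ψ x) → ∑ xs φ ≤ ∑ xs ψ
∑-mono []       h = ≤-refl
∑-mono (x ∷ xs) h = +-mono-≤ (h x (here refl)) (∑-mono xs (λ y y∈ → h y (there y∈)))

∑-nonNeg : ∀ (xs : List A) {φ} → (∀ x → x ∈ˡ xs → 0ℚ ≤ φ x) → 0ℚ ≤ ∑ xs φ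
∑-nonNeg xs h = ≤-trans (≤-reflexive (sym (∑-0 xs))) (∑-mono xs h)

∑-+ : ∀ (xs : List A) (φ ψ : A → ℚ) → ∑ xs (λ x → φ x + ψ x) ≡ ∑ xs φ + ∑ xs ψ
∑-+ []       φ ψ = refl
∑-+ (x ∷ xs) φ ψ rewrite ∑-+ xs φ ψ =
  solve 4 (λ a b c d → (a :+ b) :+ (c :+ d) := (a :+ c) :+ (b :+ d)) refl (φ x) (ψ x) (∑ xs φ) (∑ xs ψ)

∑-*ˡ : ∀ (xs : List A) c (φ : A → ℚ) → ∑ xs (λ x → c * φ x) ≡ c * ∑ xs φ
∑-*ˡ []       c φ = sym (*-zeroʳ c)
∑-*ˡ (x ∷ xs) c φ rewrite ∑-*ˡ xs c φ = sym (*-distribˡ-+ c (φ x) (∑ xs φ))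

∑-*ʳ : ∀ (xs : List A) c (φ : A → ℚ) → ∑ xs (λ x → φ x * c) ≡ ∑ xs φ * c
∑-*ʳ []       c φ = sym (*-zeroˡ c)
∑-*ʳ (x ∷ xs) c φ rewrite ∑-*ʳ xs c φ = sym (*-distribʳ-+ c (φ x) (∑ xs φ))

∑-neg : ∀ (xs : List A) (φ : A → ℚ) → ∑ xs (λ x → - φ x) ≡ - ∑ xs φ
∑-neg []       φ = refl
∑-neg (x ∷ xs) φ rewrite ∑-neg xs φ = sym (neg-distrib-+ (φ x) (∑ xs φ))

∑-- : ∀ (xs : List A) (φ ψ : A → ℚ) → ∑ xs (λ x → φ x - ψ x) ≡ ∑ xs φ - ∑ xs ψ
∑-- xs φ ψ = trans (∑-+ xs φ (λ x → - ψ x)) (cong (∑ xs φ +_) (∑-neg xs ψ))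

∑-map : ∀ (f : A → C) (xs : List A) (φ : C → ℚ) → ∑ (map f xs) φ ≡ ∑ xs (λ x → φ (f x))
∑-map f []       φ = refl
∑-map f (x ∷ xs) φ = cong (φ (f x) +_) (∑-map f xs φ)

∑-++ : ∀ (xs ys : List A) (φ : A → ℚ) → ∑ (xs ++ ys) φ ≡ ∑ xs φ + ∑ ys φ
∑-++ []       ys φ = sym (+-identityˡ _)
∑-++ (x ∷ xs) ys φ rewrite ∑-++ xs ys φ = sym (+-assoc (φ x) _ _)

∑-concatMap : ∀ (f : A → List C) (xs : List A) (φ : C → ℚ) →
              ∑ (concatMap f xs) φ ≡ ∑ xs (λ x → ∑ (f x) φ)
∑-concatMap f []       φ = refl
∑-concatMap f (x ∷ xs) φ = trans (∑-++ (f x) (concatMap f xs) φ) (cong (∑ (f x) φ +_) (∑-concatMap f xs φ))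

∑-filter : ∀ {P : A → Set} (P? : Decidable P) (xs : List A) (φ : A → ℚ) →
           ∑ (filter P? xs) φ ≡ ∑ xs (λ x → 𝟙 (P? x) * φ x)
∑-filter P? []       φ = refl
∑-filter P? (x ∷ xs) φ with P? x
... | yes _ = cong₂ _+_ (sym (*-identityˡ (φ x))) (∑-filter P? xs φ)
... | no _  = trans (∑-filter P? xs φ) (sym (trans (cong (_+ _) (*-zeroˡ (φ x))) (+-identityˡ _)))

∑-comm : ∀ (xs : List A) (ys : List C) (h : A → C → ℚ) →
         ∑ xs (λ x → ∑ ys (h x)) ≡ ∑ ys (λ y → ∑ xs (λ x → h x y))
∑-comm []       ys h = sym (∑-0 ys)
∑-comm (x ∷ xs) ys h rewrite ∑-comm xs ys h = sym (∑-+ ys (h x) (λ y → ∑ xs (λ x → h x y)))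

∑-𝟙≟ : ∀ (_≟_ : DecidableEquality A) (φ : A → ℚ) {xs} {a} → Unique xs → a ∈ˡ xs →
       ∑ xs (λ b → 𝟙 (a ≟ b) * φ b) ≡ φ a
∑-𝟙≟ _≟_ φ {x ∷ xs} {a} (x∉xs ∷ uxs) (here refl) with a ≟ a
... | no a≢a = ⊥-elim (a≢a refl)
... | yes _  = trans (cong₂ _+_ (*-identityˡ (φ a)) (∑-zero xs off)) (+-identityʳ (φ a))
  where
  off : ∀ b → b ∈ˡ xs → 𝟙 (a ≟ b) * φ b ≡ 0ℚ
  off b b∈ with a ≟ b
  ... | yes refl = ⊥-elim (All.lookup x∉xs b∈ refl)
  ... | no _     = *-zeroˡ (φ b)
∑-𝟙≟ _≟_ φ {x ∷ xs} {a} (x∉xs ∷ uxs) (there a∈) with a ≟ x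
... | yes refl = ⊥-elim (All.lookup x∉xs a∈ refl)
... | no _     = trans (cong (_+ _) (*-zeroˡ (φ x))) (trans (+-identityˡ _) (∑-𝟙≟ _≟_ φ uxs a∈))

subset-ext : (∀ i → lookup X i ≡ lookup Y i) → X ≡ Y
subset-ext {X = X} {Y = Y} h = trans (sym (tabulate∘lookup X)) (trans (tabulate-cong h) (tabulate∘lookup Y))

∈⇒lookup : i ∈ X → lookup X i ≡ true
∈⇒lookup = []=⇒lookup

lookup⇒∈ : lookup X i ≡ true → i ∈ X
lookup⇒∈ = lookup⇒[]= _ _

∉⇒lookup : ∀ {X : Subset m} {i} → i ∉ X → lookup X i ≡ false
∉⇒lookup {X = X} {i = i} i∉X with lookup X i in eq
... | true  = ⊥-elim (i∉X (lookup⇒∈ eq))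
... | false = refl

lookup⇒∉ : lookup X i ≡ false → i ∉ X
lookup⇒∉ eq i∈X with trans (sym eq) (∈⇒lookup i∈X)
... | ()

does-∈? : ∀ (i : Fin m) X → does (i ∈? X) ≡ lookup X i
does-∈? zero    (true  ∷ X) = refl
does-∈? zero    (false ∷ X) = refl
does-∈? (suc i) (_ ∷ X) with i ∈? X | does-∈? i X
... | yes _ | eq = eq
... | no _  | eq = eq

lookup-⁅⁆ : ∀ (u i : Fin m) → lookup ⁅ u ⁆ i ≡ does (u Fin.≟ i)
lookup-⁅⁆ zero    zero    = refl
lookup-⁅⁆ zero    (suc i) = lookup-replicate i false
lookup-⁅⁆ (suc u) zero    = refl
lookup-⁅⁆ (suc u) (suc i) with u Fin.≟ i | lookup-⁅⁆ u i
... | yes _ | eq = eq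
... | no _  | eq = eq

lookup-─ : ∀ (X Y : Subset m) i → lookup (X ─ Y) i ≡ lookup X i ∧ not (lookup Y i)
lookup-─ (x ∷ X) (true  ∷ Y) zero    with x
... | true  = refl
... | false = refl
lookup-─ (x ∷ X) (false ∷ Y) zero    with x
... | true  = refl
... | false = refl
lookup-─ (x ∷ X) (y ∷ Y)     (suc i) = lookup-─ X Y i

-- Set identities are proved by evaluating both sides pointwise to Boolean expressions.
infixr 7 _∩ₑ_
infixr 6 _∪ₑ_
infixl 5 _─ₑ_

data SetExpr (m : ℕ) : Set where
  var            : Subset m → SetExpr m
  ⁅_⁆ₑ           : Fin m → SetExpr m
  _∪ₑ_ _∩ₑ_ _─ₑ_ : SetExpr m → SetExpr m → SetExpr m

⟦_⟧ : SetExpr m → Subset m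
⟦ var X   ⟧ = X
⟦ ⁅ u ⁆ₑ  ⟧ = ⁅ u ⁆
⟦ e ∪ₑ e′ ⟧ = ⟦ e ⟧ ∪ ⟦ e′ ⟧
⟦ e ∩ₑ e′ ⟧ = ⟦ e ⟧ ∩ ⟦ e′ ⟧
⟦ e ─ₑ e′ ⟧ = ⟦ e ⟧ ─ ⟦ e′ ⟧

_at_ : SetExpr m → Fin m → Bool
var X   at i = lookup X i
⁅ u ⁆ₑ  at i = does (u Fin.≟ i)
(e ∪ₑ e′) at i = (e at i) ∨ (e′ at i)
(e ∩ₑ e′) at i = (e at i) ∧ (e′ at i)
(e ─ₑ e′) at i = (e at i) ∧ not (e′ at i)

lookup-⟦⟧ : ∀ (e : SetExpr m) i → lookup ⟦ e ⟧ i ≡ e at i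
lookup-⟦⟧ (var X)   i = refl
lookup-⟦⟧ ⁅ u ⁆ₑ    i = lookup-⁅⁆ u i
lookup-⟦⟧ (e ∪ₑ e′) i = trans (lookup-zipWith _ i ⟦ e ⟧ ⟦ e′ ⟧) (cong₂ _∨_ (lookup-⟦⟧ e i) (lookup-⟦⟧ e′ i))
lookup-⟦⟧ (e ∩ₑ e′) i = trans (lookup-zipWith _ i ⟦ e ⟧ ⟦ e′ ⟧) (cong₂ _∧_ (lookup-⟦⟧ e i) (lookup-⟦⟧ e′ i))
lookup-⟦⟧ (e ─ₑ e′) i =
  trans (lookup-─ ⟦ e ⟧ ⟦ e′ ⟧ i) (cong₂ (λ a b → a ∧ not b) (lookup-⟦⟧ e i) (lookup-⟦⟧ e′ i))

⟦⟧-ext : ∀ (e e′ : SetExpr m) → (∀ i → e at i ≡ e′ at i) → ⟦ e ⟧ ≡ ⟦ e′ ⟧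
⟦⟧-ext e e′ h = subset-ext (λ i → trans (lookup-⟦⟧ e i) (trans (h i) (sym (lookup-⟦⟧ e′ i))))

swap-∪-self : ∀ {S : Subset m} {u g} → g ∈ S → (S ∪ ⁅ u ⁆ ─ ⁅ g ⁆) ∪ S ≡ S ∪ ⁅ u ⁆
swap-∪-self {S = S} {u = u} {g = g} g∈S =
  ⟦⟧-ext ((var S ∪ₑ ⁅ u ⁆ₑ ─ₑ ⁅ g ⁆ₑ) ∪ₑ var S) (var S ∪ₑ ⁅ u ⁆ₑ) pointwise
  where
  pointwise : ∀ i → ((var S ∪ₑ ⁅ u ⁆ₑ ─ₑ ⁅ g ⁆ₑ) ∪ₑ var S) at i ≡ (var S ∪ₑ ⁅ u ⁆ₑ) at i
  pointwise i with g Fin.≟ i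
  ... | yes refl rewrite ∈⇒lookup g∈S = refl
  ... | no _ with lookup S i | does (u Fin.≟ i)
  ...   | true  | _     = refl
  ...   | false | true  = refl
  ...   | false | false = refl

swap-∩-self : ∀ {S : Subset m} {u g} → (S ∪ ⁅ u ⁆ ─ ⁅ g ⁆) ∩ S ≡ S ─ ⁅ g ⁆
swap-∩-self {S = S} {u = u} {g = g} =
  ⟦⟧-ext ((var S ∪ₑ ⁅ u ⁆ₑ ─ₑ ⁅ g ⁆ₑ) ∩ₑ var S) (var S ─ₑ ⁅ g ⁆ₑ) pointwise
  where
  pointwise : ∀ i → ((var S ∪ₑ ⁅ u ⁆ₑ ─ₑ ⁅ g ⁆ₑ) ∩ₑ var S) at i ≡ (var S ─ₑ ⁅ g ⁆ₑ) at i
  pointwise i with lookup S i | does (u Fin.≟ i) | does (g Fin.≟ i)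
  ... | true  | _     | true  = refl
  ... | true  | _     | false = refl
  ... | false | true  | true  = refl
  ... | false | true  | false = refl
  ... | false | false | _     = refl

add-∪-add : ∀ {S T : Subset m} {u} → (S ∪ ⁅ u ⁆) ∪ (S ∪ T) ≡ S ∪ (⁅ u ⁆ ∪ T)
add-∪-add {S = S} {T = T} {u = u} =
  ⟦⟧-ext ((var S ∪ₑ ⁅ u ⁆ₑ) ∪ₑ (var S ∪ₑ var T)) (var S ∪ₑ (⁅ u ⁆ₑ ∪ₑ var T)) pointwise
  where
  pointwise : ∀ i → ((var S ∪ₑ ⁅ u ⁆ₑ) ∪ₑ (var S ∪ₑ var T)) at i ≡ (var S ∪ₑ (⁅ u ⁆ₑ ∪ₑ var T)) at i
  pointwise i with lookup S i | does (u Fin.≟ i)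
  ... | true  | _     = refl
  ... | false | true  = refl
  ... | false | false = refl

add-∩-add : ∀ {S T : Subset m} {u} → u ∉ T → (S ∪ ⁅ u ⁆) ∩ (S ∪ T) ≡ S
add-∩-add {S = S} {T = T} {u = u} u∉T =
  ⟦⟧-ext ((var S ∪ₑ ⁅ u ⁆ₑ) ∩ₑ (var S ∪ₑ var T)) (var S) pointwise
  where
  pointwise : ∀ i → ((var S ∪ₑ ⁅ u ⁆ₑ) ∩ₑ (var S ∪ₑ var T)) at i ≡ var S at i
  pointwise i with u Fin.≟ i
  ... | yes refl rewrite ∉⇒lookup u∉T with lookup S u
  ...   | true  = refl
  ...   | false = refl
  pointwise i | no _ with lookup S i
  ...   | true  = refl
  ...   | false = refl

remove-∪-insert : ∀ {S T : Subset m} {v} → v ∈ S → T ⊆ S → (S ─ ⁅ v ⁆) ∪ (⁅ v ⁆ ∪ T) ≡ S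
remove-∪-insert {S = S} {T = T} {v = v} v∈S T⊆S =
  ⟦⟧-ext ((var S ─ₑ ⁅ v ⁆ₑ) ∪ₑ (⁅ v ⁆ₑ ∪ₑ var T)) (var S) pointwise
  where
  pointwise : ∀ i → ((var S ─ₑ ⁅ v ⁆ₑ) ∪ₑ (⁅ v ⁆ₑ ∪ₑ var T)) at i ≡ var S at i
  pointwise i with v Fin.≟ i
  ... | yes refl rewrite ∈⇒lookup v∈S = refl
  ... | no _ with lookup T i in i∈T
  ...   | true  rewrite ∈⇒lookup (T⊆S (lookup⇒∈ i∈T)) = refl
  ...   | false with lookup S i
  ...     | true  = refl
  ...     | false = refl

remove-∩-insert : ∀ {S T : Subset m} {v} → v ∉ T → T ⊆ S → (S ─ ⁅ v ⁆) ∩ (⁅ v ⁆ ∪ T) ≡ T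
remove-∩-insert {S = S} {T = T} {v = v} v∉T T⊆S =
  ⟦⟧-ext ((var S ─ₑ ⁅ v ⁆ₑ) ∩ₑ (⁅ v ⁆ₑ ∪ₑ var T)) (var T) pointwise
  where
  pointwise : ∀ i → ((var S ─ₑ ⁅ v ⁆ₑ) ∩ₑ (⁅ v ⁆ₑ ∪ₑ var T)) at i ≡ var T at i
  pointwise i with v Fin.≟ i
  ... | yes refl rewrite ∉⇒lookup v∉T with lookup S v
  ...   | true  = refl
  ...   | false = refl
  pointwise i | no _ with lookup T i in i∈T
  ...   | true  rewrite ∈⇒lookup (T⊆S (lookup⇒∈ i∈T)) = refl
  ...   | false with lookup S i
  ...     | true  = refl
  ...     | false = refl

restrict-∪-remove : ∀ {P T W : Subset m} {v} → v ∈ T → v ∈ W → (P ∪ T ∩ W) ∪ (P ∪ (W ─ ⁅ v ⁆)) ≡ P ∪ W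
restrict-∪-remove {P = P} {T = T} {W = W} {v = v} v∈T v∈W =
  ⟦⟧-ext ((var P ∪ₑ var T ∩ₑ var W) ∪ₑ (var P ∪ₑ (var W ─ₑ ⁅ v ⁆ₑ))) (var P ∪ₑ var W) pointwise
  where
  pointwise : ∀ i → ((var P ∪ₑ var T ∩ₑ var W) ∪ₑ (var P ∪ₑ (var W ─ₑ ⁅ v ⁆ₑ))) at i ≡ (var P ∪ₑ var W) at i
  pointwise i with v Fin.≟ i
  ... | yes refl rewrite ∈⇒lookup v∈T | ∈⇒lookup v∈W with lookup P v
  ...   | true  = refl
  ...   | false = refl
  pointwise i | no _ with lookup P i | lookup T i | lookup W i
  ...   | true  | _     | _     = refl
  ...   | false | true  | true  = refl
  ...   | false | true  | false = refl
  ...   | false | false | true  = refl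
  ...   | false | false | false = refl

restrict-∩-remove : ∀ {P T W : Subset m} {v} → (P ∪ T ∩ W) ∩ (P ∪ (W ─ ⁅ v ⁆)) ≡ P ∪ T ∩ (W ─ ⁅ v ⁆)
restrict-∩-remove {P = P} {T = T} {W = W} {v = v} =
  ⟦⟧-ext ((var P ∪ₑ var T ∩ₑ var W) ∩ₑ (var P ∪ₑ (var W ─ₑ ⁅ v ⁆ₑ))) (var P ∪ₑ var T ∩ₑ (var W ─ₑ ⁅ v ⁆ₑ))
         pointwise
  where
  pointwise : ∀ i → ((var P ∪ₑ var T ∩ₑ var W) ∩ₑ (var P ∪ₑ (var W ─ₑ ⁅ v ⁆ₑ))) at i
                  ≡ (var P ∪ₑ var T ∩ₑ (var W ─ₑ ⁅ v ⁆ₑ)) at i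
  pointwise i with lookup P i | lookup T i | lookup W i | does (v Fin.≟ i)
  ... | true  | _     | _     | _     = refl
  ... | false | true  | true  | true  = refl
  ... | false | true  | true  | false = refl
  ... | false | true  | false | _     = refl
  ... | false | false | _     | _     = refl

∩-remove-∉ : ∀ {T W : Subset m} {v} → v ∉ T → T ∩ (W ─ ⁅ v ⁆) ≡ T ∩ W
∩-remove-∉ {T = T} {W = W} {v = v} v∉T =
  ⟦⟧-ext (var T ∩ₑ (var W ─ₑ ⁅ v ⁆ₑ)) (var T ∩ₑ var W) pointwise
  where
  pointwise : ∀ i → (var T ∩ₑ (var W ─ₑ ⁅ v ⁆ₑ)) at i ≡ (var T ∩ₑ var W) at i
  pointwise i with v Fin.≟ i
  ... | yes refl rewrite ∉⇒lookup v∉T = refl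
  ... | no _ with lookup T i | lookup W i
  ...   | true  | true  = refl
  ...   | true  | false = refl
  ...   | false | _     = refl

∣⁅x⁆∪p∣≡1+∣p∣ : ∀ (x : Fin m) (xs : Subset m) → x ∉ xs → ∣ ⁅ x ⁆ ∪ xs ∣ ≡ suc ∣ xs ∣
∣⁅x⁆∪p∣≡1+∣p∣ zero    (true  ∷ xs) x∉ = ⊥-elim (x∉ Data.Vec.here)
∣⁅x⁆∪p∣≡1+∣p∣ zero    (false ∷ xs) x∉ = cong (suc ∘ ∣_∣) (∪-identityˡ xs)
∣⁅x⁆∪p∣≡1+∣p∣ (suc x) (true  ∷ xs) x∉ = cong suc (∣⁅x⁆∪p∣≡1+∣p∣ x xs (x∉ ∘ Data.Vec.there))
∣⁅x⁆∪p∣≡1+∣p∣ (suc x) (false ∷ xs) x∉ = ∣⁅x⁆∪p∣≡1+∣p∣ x xs (x∉ ∘ Data.Vec.there)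

∃∉ : ∀ {m} {X : Subset m} → ∣ X ∣ ℕ.< m → ∃ λ i → i ∉ X
∃∉ {m} {X} ∣X∣<m = ¬∀⟶∃¬ m (_∈ X) (_∈? X) λ all∈X →
  ℕ.<⇒≱ ∣X∣<m (subst (ℕ._≤ ∣ X ∣) (∣⊤∣≡n m) (p⊆q⇒∣p∣≤∣q∣ {p = ⊤} (λ {x} _ → all∈X x)))

unique-map : ∀ (h : A → C) {xs} → Unique xs → (∀ {a b} → a ∈ˡ xs → b ∈ˡ xs → h a ≡ h b → a ≡ b) →
             Unique (map h xs)
unique-map h {[]}     []           _      = []
unique-map h {x ∷ xs} (x∉xs ∷ uxs) h-inj =
  All.map⁺ (All.tabulate (λ y∈ hx≡hy → All.lookup x∉xs y∈ (h-inj (here refl) (there y∈) hx≡hy)))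
  ∷ unique-map h uxs (λ a∈ b∈ → h-inj (there a∈) (there b∈))

elements : Subset m → List (Fin m)
elements X = filter (_∈? X) (allFin _)

elements-unique : ∀ (X : Subset m) → Unique (elements X)
elements-unique {m} X = Unique.filter⁺ (_∈? X) (Unique.allFin⁺ m)

∈-elements⁺ : i ∈ X → i ∈ˡ elements X
∈-elements⁺ {X = X} i∈X = ∈-filter⁺ (_∈? X) (∈-allFin _) i∈X

∈-elements⁻ : i ∈ˡ elements X → i ∈ X
∈-elements⁻ {X = X} i∈ = proj₂ (∈-filter⁻ (_∈? X) {xs = allFin _} i∈)

fromList : List (Fin m) → Subset m
fromList xs = ⋃ (map ⁅_⁆ xs)

∈-fromList⁺ : ∀ {xs} → i ∈ˡ xs → i ∈ fromList xs
∈-fromList⁺ (here refl) = x∈p∪q⁺ (inj₁ (x∈⁅x⁆ _))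
∈-fromList⁺ (there i∈)  = x∈p∪q⁺ (inj₂ (∈-fromList⁺ i∈))

∈-fromList⁻ : ∀ xs → i ∈ fromList xs → i ∈ˡ xs
∈-fromList⁻ []       i∈ = ⊥-elim (∉⊥ i∈)
∈-fromList⁻ (x ∷ xs) i∈ with x∈p∪q⁻ ⁅ x ⁆ (fromList xs) i∈
... | inj₁ i∈⁅x⁆ = here (x∈⁅y⁆⇒x≡y x i∈⁅x⁆)
... | inj₂ i∈xs  = there (∈-fromList⁻ xs i∈xs)

fromList-elements : ∀ (X : Subset m) → fromList (elements X) ≡ X
fromList-elements X = ⊆-antisym (∈-elements⁻ ∘ ∈-fromList⁻ (elements X)) (∈-fromList⁺ ∘ ∈-elements⁺)

∣fromList∣ : ∀ {xs : List (Fin m)} → Unique xs → ∣ fromList xs ∣ ≡ length xs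
∣fromList∣ {m} {[]}     _            = ∣⊥∣≡0 m
∣fromList∣ {m} {x ∷ xs} (x∉xs ∷ uxs) =
  trans (∣⁅x⁆∪p∣≡1+∣p∣ x (fromList xs) (λ x∈ → All.lookup x∉xs (∈-fromList⁻ xs x∈) refl))
        (cong suc (∣fromList∣ uxs))

∣∣≡length-elements : ∀ (X : Subset m) → ∣ X ∣ ≡ length (elements X)
∣∣≡length-elements X = trans (cong ∣_∣ (sym (fromList-elements X))) (∣fromList∣ (elements-unique X))

⊆∧∣⊇∣⇒≡ : X ⊆ Y → ∣ Y ∣ ℕ.≤ ∣ X ∣ → X ≡ Y
⊆∧∣⊇∣⇒≡ {X = X} {Y = Y} X⊆Y ∣Y∣≤∣X∣ = ⊆-antisym X⊆Y Y⊆X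
  where
  Y⊆X : Y ⊆ X
  Y⊆X {i} i∈Y with i ∈? X
  ... | yes i∈X = i∈X
  ... | no i∉X  = ⊥-elim (ℕ.<⇒≱ (p⊂q⇒∣p∣<∣q∣ (X⊆Y , i , i∈Y , i∉X)) ∣Y∣≤∣X∣)

does-≟-sym : ∀ (i j : Fin m) → does (i Fin.≟ j) ≡ does (j Fin.≟ i)
does-≟-sym i j with i Fin.≟ j | j Fin.≟ i
... | yes _    | yes _    = refl
... | no _     | no _     = refl
... | yes refl | no j≢i   = ⊥-elim (j≢i refl)
... | no i≢j   | yes refl = ⊥-elim (i≢j refl)

lookup-take : ∀ n {k} (S : Subset (n ℕ.+ k)) (w : Fin n) → lookup (take n S) w ≡ lookup S (w ↑ˡ k)
lookup-take (suc n) (s ∷ S) zero    = refl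
lookup-take (suc n) (s ∷ S) (suc w) = lookup-take n S w

lookup-drop : ∀ n {k} (S : Subset (n ℕ.+ k)) (j : Fin k) → lookup (drop n S) j ≡ lookup S (n ↑ʳ j)
lookup-drop zero     S       j = refl
lookup-drop (suc n) (s ∷ S) j = lookup-drop n S j

take-++ : ∀ {n k} (X : Subset n) (Y : Subset k) → take n (X ++ᵥ Y) ≡ X
take-++ []      Y = refl
take-++ (x ∷ X) Y = cong (x ∷_) (take-++ X Y)

take-⁅↑ʳ⁆ : ∀ n {k} (j : Fin k) → take n ⁅ n ↑ʳ j ⁆ ≡ ⊥
take-⁅↑ʳ⁆ zero     j = refl
take-⁅↑ʳ⁆ (suc n) j = cong (false ∷_) (take-⁅↑ʳ⁆ n j)

∣++∣ : ∀ {n k} (X : Subset n) (Y : Subset k) → ∣ X ++ᵥ Y ∣ ≡ ∣ X ∣ ℕ.+ ∣ Y ∣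
∣++∣ []          Y = refl
∣++∣ (true  ∷ X) Y = cong suc (∣++∣ X Y)
∣++∣ (false ∷ X) Y = ∣++∣ X Y

subset-of-size : ∀ {t} → t ℕ.≤ m → ∃ λ (X : Subset m) → ∣ X ∣ ≡ t
subset-of-size {zero}  {t = zero}  _         = [] , refl
subset-of-size {suc m} {t = zero}  _         with subset-of-size {m} z≤n
... | X , ∣X∣≡0 = false ∷ X , ∣X∣≡0
subset-of-size {suc m} {t = suc t} (s≤s t≤m) with subset-of-size t≤m
... | X , ∣X∣≡t = true ∷ X , cong suc ∣X∣≡t

min-element : ∀ (φ : Fin m → ℚ) {W} → Nonempty W → ∃ λ v → v ∈ W × ∀ w → w ∈ W → φ v ≤ φ w
min-element φ {W} (x , x∈W) with elements W in eq
... | []     = ⊥-elim (Any.¬Any[] (subst (x ∈ˡ_) eq (∈-elements⁺ x∈W)))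
... | y ∷ ys = argmin φ y ys , argmin∈W , argmin-minimal
  where
  in-W : ∀ {w} → w ∈ˡ y ∷ ys → w ∈ W
  in-W w∈ = ∈-elements⁻ (subst (_ ∈ˡ_) (sym eq) w∈)
  argmin∈W : argmin φ y ys ∈ W
  argmin∈W = argmin-all φ (in-W (here refl)) (All.tabulate (in-W ∘ there))
  argmin-minimal : ∀ w → w ∈ W → φ (argmin φ y ys) ≤ φ w
  argmin-minimal w w∈W with subst (w ∈ˡ_) eq (∈-elements⁺ w∈W)
  ... | here refl  = f[argmin]≤f[⊤] {f = φ} y ys
  ... | there w∈ys = All.lookup (f[argmin]≤f[xs] {f = φ} y ys) w∈ys

NonNegWeights : Dist m → Set
NonNegWeights D = All (λ w → 0ℚ ≤ proj₁ w) D

𝔼-cong : ∀ (D : Dist m) {φ ψ} → (∀ S → InSupp D S → φ S ≡ ψ S) → 𝔼 D φ ≡ 𝔼 D ψ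
𝔼-cong []            h = refl
𝔼-cong ((p , S) ∷ D) h = cong₂ _+_ (cong (p *_) (h S (here refl))) (𝔼-cong D (λ T T∈ → h T (there T∈)))

𝔼-mono : ∀ {D : Dist m} {φ ψ} → NonNegWeights D → (∀ S → InSupp D S → φ S ≤ ψ S) → 𝔼 D φ ≤ 𝔼 D ψ
𝔼-mono {D = []}          []          h = ≤-refl
𝔼-mono {D = (p , S) ∷ D} (0≤p ∷ 0≤D) h =
  +-mono-≤ (*-monoˡ-≤-≥0 0≤p (h S (here refl))) (𝔼-mono 0≤D (λ T T∈ → h T (there T∈)))

𝔼-nonNeg : ∀ {D : Dist m} {φ} → NonNegWeights D → (∀ S → InSupp D S → 0ℚ ≤ φ S) → 0ℚ ≤ 𝔼 D φ
𝔼-nonNeg {D = D} 0≤D h = ≤-trans (≤-reflexive (sym (∑-zero D (λ w _ → *-zeroʳ (proj₁ w))))) (𝔼-mono 0≤D h)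

𝔼-+ : ∀ (D : Dist m) (φ ψ : Subset m → ℚ) → 𝔼 D (λ S → φ S + ψ S) ≡ 𝔼 D φ + 𝔼 D ψ
𝔼-+ D φ ψ = trans (∑-cong D (λ w _ → *-distribˡ-+ (proj₁ w) (φ (proj₂ w)) (ψ (proj₂ w)))) (∑-+ D _ _)

𝔼-- : ∀ (D : Dist m) (φ ψ : Subset m → ℚ) → 𝔼 D (λ S → φ S - ψ S) ≡ 𝔼 D φ - 𝔼 D ψ
𝔼-- D φ ψ = trans (∑-cong D (λ w _ → distrib (proj₁ w) (φ (proj₂ w)) (ψ (proj₂ w)))) (∑-- D _ _)
  where
  distrib : ∀ p a b → p * (a - b) ≡ p * a - p * b
  distrib = solve 3 (λ p a b → p :* (a :- b) := p :* a :- p :* b) refl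

𝔼-*ʳ : ∀ (D : Dist m) c (φ : Subset m → ℚ) → 𝔼 D (λ S → φ S * c) ≡ 𝔼 D φ * c
𝔼-*ʳ D c φ = trans (∑-cong D (λ w _ → sym (*-assoc (proj₁ w) (φ (proj₂ w)) c))) (∑-*ʳ D c _)

𝔼-const : ∀ {D : Dist m} c → 𝔼 D (λ _ → 1ℚ) ≡ 1ℚ → 𝔼 D (λ _ → c) ≡ c
𝔼-const {D = D} c mass = begin
  𝔼 D (λ _ → c)          ≡⟨ 𝔼-cong D (λ _ _ → sym (*-identityˡ c)) ⟩
  𝔼 D (λ _ → 1ℚ * c)     ≡⟨ 𝔼-*ʳ D c (λ _ → 1ℚ) ⟩
  𝔼 D (λ _ → 1ℚ) * c     ≡⟨ cong (_* c) mass ⟩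
  1ℚ * c                 ≡⟨ *-identityˡ c ⟩
  c                      ∎
  where open ≡-Reasoning

𝔼-∑ : ∀ (D : Dist m) (xs : List A) (h : A → Subset m → ℚ) →
      𝔼 D (λ S → ∑ xs (λ u → h u S)) ≡ ∑ xs (λ u → 𝔼 D (h u))
𝔼-∑ D xs h = trans (∑-cong D (λ w _ → sym (∑-*ˡ xs (proj₁ w) (λ u → h u (proj₂ w)))))
                   (∑-comm D xs (λ w u → proj₁ w * h u (proj₂ w)))

supp-unique : ∀ (D : Dist m) → Unique (supp D)
supp-unique D = deduplicate-! _≟ₛ_ (map proj₂ D)

∈supp⇒InSupp : ∀ (D : Dist m) {S} → S ∈ˡ supp D → InSupp D S
∈supp⇒InSupp D S∈ = Any.map sym (Any.map⁻ (∈-deduplicate⁻ _≟ₛ_ (map proj₂ D) S∈))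

PrSet-nonNeg : ∀ {D : Dist m} → NonNegWeights D → ∀ S → 0ℚ ≤ PrSet D S
PrSet-nonNeg {D = D} 0≤D S = ∑-nonNeg (filter (λ w → proj₂ w ≟ₛ S) D)
  (λ w w∈ → All.lookup 0≤D (proj₁ (∈-filter⁻ (λ w → proj₂ w ≟ₛ S) {xs = D} w∈)))

-- Stated for any duplicate-free list of sets covering D, not just supp D, so that induction on D goes through.
𝔼-by-sets : ∀ (D : Dist m) (ψ : Subset m → ℚ) {Ss} → Unique Ss → (∀ {w} → w ∈ˡ D → proj₂ w ∈ˡ Ss) →
            ∑ Ss (λ S → PrSet D S * ψ S) ≡ 𝔼 D ψ
𝔼-by-sets []            ψ {Ss} uSs cover = ∑-zero Ss (λ S _ → *-zeroˡ (ψ S))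
𝔼-by-sets ((p , T) ∷ D) ψ {Ss} uSs cover = begin
  ∑ Ss (λ S → PrSet ((p , T) ∷ D) S * ψ S)
    ≡⟨ ∑-cong Ss (λ S _ → split S) ⟩
  ∑ Ss (λ S → 𝟙 (T ≟ₛ S) * (p * ψ S) + PrSet D S * ψ S)
    ≡⟨ ∑-+ Ss _ _ ⟩
  ∑ Ss (λ S → 𝟙 (T ≟ₛ S) * (p * ψ S)) + ∑ Ss (λ S → PrSet D S * ψ S)
    ≡⟨ cong₂ _+_ (∑-𝟙≟ _≟ₛ_ (λ S → p * ψ S) uSs (cover (here refl))) (𝔼-by-sets D ψ uSs (cover ∘ there)) ⟩
  p * ψ T + 𝔼 D ψ
    ∎
  where
  open ≡-Reasoning
  split : ∀ S → PrSet ((p , T) ∷ D) S * ψ S ≡ 𝟙 (T ≟ₛ S) * (p * ψ S) + PrSet D S * ψ S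
  split S with T ≟ₛ S
  ... | yes _ = solve 3 (λ p r s → (p :+ r) :* s := con 1ℚ :* (p :* s) :+ r :* s) refl p (PrSet D S) (ψ S)
  ... | no _  = solve 3 (λ p r s → r :* s := con 0ℚ :* (p :* s) :+ r :* s) refl p (PrSet D S) (ψ S)

𝔼-by-supp : ∀ (D : Dist m) (ψ : Subset m → ℚ) → ∑ (supp D) (λ S → PrSet D S * ψ S) ≡ 𝔼 D ψ
𝔼-by-supp D ψ = 𝔼-by-sets D ψ (supp-unique D) (λ w∈ → ∈-deduplicate⁺ _≟ₛ_ (∈-map⁺ proj₂ w∈))

Pr∈ : Dist m → Fin m → ℚ
Pr∈ D v = 𝔼 D (λ S → 𝟙 (v ∈? S))

module Submodularity (F : Subset m → ℚ) (F-sub : Submodular F) where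

  submodular-≡ : ∀ {X Y U V} → X ∪ Y ≡ U → X ∩ Y ≡ V → F U + F V ≤ F X + F Y
  submodular-≡ {X} {Y} refl refl = F-sub X Y

  exchange-≤ : ∀ {S g} u → g ∈ S →
               F S + (F (S ∪ ⁅ u ⁆) - F S) - (F S - F (S ─ ⁅ g ⁆)) ≤ F (S ∪ ⁅ u ⁆ ─ ⁅ g ⁆)
  exchange-≤ {S} {g} u g∈S = ≤-by-slack (submodular-≡ (swap-∪-self {u = u} g∈S) swap-∩-self)
    (solve 4 (λ s a b c → s :+ (a :- s) :- (s :- b) :+ ((c :+ s) :- (a :+ b)) := c) refl
      (F S) (F (S ∪ ⁅ u ⁆)) (F (S ─ ⁅ g ⁆)) (F (S ∪ ⁅ u ⁆ ─ ⁅ g ⁆)))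

  ∑-marginals-≥ : ∀ S {xs} → Unique xs → F (S ∪ fromList xs) - F S ≤ ∑ xs (λ u → F (S ∪ ⁅ u ⁆) - F S)
  ∑-marginals-≥ S {[]} _ = ≤-reflexive (trans (cong (λ T → F T - F S) (∪-identityʳ S)) (+-inverseʳ (F S)))
  ∑-marginals-≥ S {u ∷ xs} (u∉xs ∷ uxs) = begin
    F (S ∪ (⁅ u ⁆ ∪ T)) - F S
      ≡⟨ telescope (F (S ∪ (⁅ u ⁆ ∪ T))) (F (S ∪ T)) (F S) ⟩
    (F (S ∪ (⁅ u ⁆ ∪ T)) - F (S ∪ T)) + (F (S ∪ T) - F S)
      ≤⟨ +-mono-≤ add-u (∑-marginals-≥ S uxs) ⟩
    (F (S ∪ ⁅ u ⁆) - F S) + ∑ xs (λ u → F (S ∪ ⁅ u ⁆) - F S)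
      ∎
    where
    open ℚ.≤-Reasoning
    T : Subset m
    T = fromList xs
    add-u : F (S ∪ (⁅ u ⁆ ∪ T)) - F (S ∪ T) ≤ F (S ∪ ⁅ u ⁆) - F S
    add-u = ≤-by-slack (submodular-≡ add-∪-add (add-∩-add (λ u∈T → All.lookup u∉xs (∈-fromList⁻ xs u∈T) refl)))
      (solve 4 (λ a b c d → a :- b :+ ((c :+ b) :- (a :+ d)) := c :- d) refl
        (F (S ∪ (⁅ u ⁆ ∪ T))) (F (S ∪ T)) (F (S ∪ ⁅ u ⁆)) (F S))

  ΣIn-marginals-≥ : ∀ S B → F (S ∪ B) - F S ≤ ΣIn B (λ u → F (S ∪ ⁅ u ⁆) - F S)
  ΣIn-marginals-≥ S B = subst (λ B′ → F (S ∪ B′) - F S ≤ ΣIn B (λ u → F (S ∪ ⁅ u ⁆) - F S))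
    (fromList-elements B) (∑-marginals-≥ S (elements-unique B))

  ∑-removal-marginals-≤ : ∀ X {xs} → Unique xs → fromList xs ⊆ X →
                          ∑ xs (λ v → F X - F (X ─ ⁅ v ⁆)) ≤ F (fromList xs) - F ⊥
  ∑-removal-marginals-≤ X {[]} _ _ = ≤-reflexive (sym (+-inverseʳ (F ⊥)))
  ∑-removal-marginals-≤ X {v ∷ xs} (v∉xs ∷ uxs) v∷xs⊆X = begin
    (F X - F (X ─ ⁅ v ⁆)) + ∑ xs (λ v → F X - F (X ─ ⁅ v ⁆))
      ≤⟨ +-mono-≤ remove-v (∑-removal-marginals-≤ X uxs T⊆X) ⟩
    (F (⁅ v ⁆ ∪ T) - F T) + (F T - F ⊥)
      ≡⟨ telescope (F (⁅ v ⁆ ∪ T)) (F T) (F ⊥) ⟨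
    F (⁅ v ⁆ ∪ T) - F ⊥
      ∎
    where
    open ℚ.≤-Reasoning
    T : Subset m
    T = fromList xs
    T⊆X : T ⊆ X
    T⊆X i∈T = v∷xs⊆X (x∈p∪q⁺ (inj₂ i∈T))
    remove-v : F X - F (X ─ ⁅ v ⁆) ≤ F (⁅ v ⁆ ∪ T) - F T
    remove-v = ≤-by-slack (submodular-≡ (remove-∪-insert (v∷xs⊆X (x∈p∪q⁺ (inj₁ (x∈⁅x⁆ v)))) T⊆X)
                                        (remove-∩-insert (λ v∈T → All.lookup v∉xs (∈-fromList⁻ xs v∈T) refl) T⊆X))
      (solve 4 (λ x y a t → x :- y :+ ((y :+ a) :- (x :+ t)) := a :- t) refl
        (F X) (F (X ─ ⁅ v ⁆)) (F (⁅ v ⁆ ∪ T)) (F T))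

  -- The sampling lemma, by induction on W, peeling off its element of least probability.
  module Sampling (F≥0 : NonNegative F) {D : Dist m} (0≤D : NonNegWeights D) (mass : 𝔼 D (λ _ → 1ℚ) ≡ 1ℚ)
                  (P : Subset m) where

    sampling-step : ∀ {v W} → v ∈ W →
      𝔼 D (λ T → F (P ∪ T ∩ (W ─ ⁅ v ⁆))) + Pr∈ D v * (F (P ∪ W) - F (P ∪ (W ─ ⁅ v ⁆)))
        ≤ 𝔼 D (λ T → F (P ∪ T ∩ W))
    sampling-step {v} {W} v∈W = begin
      𝔼 D (λ T → F (P ∪ T ∩ W′)) + Pr∈ D v * K
        ≡⟨ cong (𝔼 D (λ T → F (P ∪ T ∩ W′)) +_) (𝔼-*ʳ D K (λ T → 𝟙 (v ∈? T))) ⟨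
      𝔼 D (λ T → F (P ∪ T ∩ W′)) + 𝔼 D (λ T → 𝟙 (v ∈? T) * K)
        ≡⟨ 𝔼-+ D _ _ ⟨
      𝔼 D (λ T → F (P ∪ T ∩ W′) + 𝟙 (v ∈? T) * K)
        ≤⟨ 𝔼-mono 0≤D (λ T _ → pointwise T) ⟩
      𝔼 D (λ T → F (P ∪ T ∩ W))
        ∎
      where
      open ℚ.≤-Reasoning
      W′ : Subset m
      W′ = W ─ ⁅ v ⁆
      K : ℚ
      K = F (P ∪ W) - F (P ∪ W′)
      pointwise : ∀ T → F (P ∪ T ∩ W′) + 𝟙 (v ∈? T) * K ≤ F (P ∪ T ∩ W)
      pointwise T with v ∈? T
      ... | yes v∈T = ≤-by-slack (submodular-≡ (restrict-∪-remove v∈T v∈W) restrict-∩-remove)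
        (solve 4 (λ a b c d → a :+ con 1ℚ :* (b :- d) :+ ((c :+ d) :- (b :+ a)) := c) refl
          (F (P ∪ T ∩ W′)) (F (P ∪ W)) (F (P ∪ T ∩ W)) (F (P ∪ W′)))
      ... | no v∉T = ≤-reflexive (begin-equality
        F (P ∪ T ∩ W′) + 0ℚ * K  ≡⟨ cong (F (P ∪ T ∩ W′) +_) (*-zeroˡ K) ⟩
        F (P ∪ T ∩ W′) + 0ℚ      ≡⟨ +-identityʳ _ ⟩
        F (P ∪ T ∩ W′)           ≡⟨ cong (λ Z → F (P ∪ Z)) (∩-remove-∉ {W = W} v∉T) ⟩
        F (P ∪ T ∩ W)            ∎)

    sampling-bound : ∀ c W → ∣ W ∣ ℕ.≤ c → ∀ {q r} → r ≤ q →
                     (∀ v → v ∈ W → r ≤ Pr∈ D v) → (∀ v → Pr∈ D v ≤ q) →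
                     (1ℚ - q) * F P + r * F (P ∪ W) ≤ 𝔼 D (λ T → F (P ∪ T ∩ W))
    sampling-bound c W ∣W∣≤c {q} {r} r≤q r≤Pr Pr≤q with nonempty? W
    ... | no W-empty rewrite Empty-unique W-empty = begin
      (1ℚ - q) * F P + r * F (P ∪ ⊥)
        ≡⟨ cong (λ Z → (1ℚ - q) * F P + r * F Z) (∪-identityʳ P) ⟩
      (1ℚ - q) * F P + r * F P
        ≤⟨ +-monoʳ-≤ ((1ℚ - q) * F P) (*-monoʳ-≤-≥0 (F≥0 P) r≤q) ⟩
      (1ℚ - q) * F P + q * F P
        ≡⟨ solve 2 (λ q x → (con 1ℚ :- q) :* x :+ q :* x := x) refl q (F P) ⟩
      F P
        ≡⟨ 𝔼-const {D = D} (F P) mass ⟨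
      𝔼 D (λ _ → F P)
        ≡⟨ 𝔼-cong D (λ T _ → cong F (trans (cong (P ∪_) (∩-zeroʳ T)) (∪-identityʳ P))) ⟨
      𝔼 D (λ T → F (P ∪ T ∩ ⊥))
        ∎
      where open ℚ.≤-Reasoning
    ... | yes W-nonempty = by-min-element c ∣W∣≤c (min-element (Pr∈ D) W-nonempty)
      where
      by-min-element : ∀ c → ∣ W ∣ ℕ.≤ c → (∃ λ v → v ∈ W × ∀ w → w ∈ W → Pr∈ D v ≤ Pr∈ D w) →
                       (1ℚ - q) * F P + r * F (P ∪ W) ≤ 𝔼 D (λ T → F (P ∪ T ∩ W))
      by-min-element zero    ∣W∣≤0 (v , v∈W , _) =
        ⊥-elim (ℕ.<⇒≱ (x∈p⇒∣p-x∣<∣p∣ v∈W) (ℕ.≤-trans ∣W∣≤0 z≤n))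
      by-min-element (suc c) ∣W∣≤c (v , v∈W , v-min) = begin
        (1ℚ - q) * F P + r * F (P ∪ W)
          ≤⟨ +-monoʳ-≤ ((1ℚ - q) * F P) (*-monoʳ-≤-≥0 (F≥0 (P ∪ W)) (r≤Pr v v∈W)) ⟩
        (1ℚ - q) * F P + Prᵥ * F (P ∪ W)
          ≡⟨ solve 4 (λ a s x y → a :+ s :* x := a :+ s :* y :+ s :* (x :- y)) refl
                     ((1ℚ - q) * F P) Prᵥ (F (P ∪ W)) (F (P ∪ W′)) ⟩
        (1ℚ - q) * F P + Prᵥ * F (P ∪ W′) + Prᵥ * K
          ≤⟨ +-monoˡ-≤ (Prᵥ * K) smaller ⟩
        𝔼 D (λ T → F (P ∪ T ∩ W′)) + Prᵥ * K
          ≤⟨ sampling-step v∈W ⟩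
        𝔼 D (λ T → F (P ∪ T ∩ W))
          ∎
        where
        open ℚ.≤-Reasoning
        Prᵥ : ℚ
        Prᵥ = Pr∈ D v
        W′ : Subset m
        W′ = W ─ ⁅ v ⁆
        K : ℚ
        K = F (P ∪ W) - F (P ∪ W′)
        smaller : (1ℚ - q) * F P + Prᵥ * F (P ∪ W′) ≤ 𝔼 D (λ T → F (P ∪ T ∩ W′))
        smaller = sampling-bound c W′ (ℕ.≤-pred (ℕ.≤-trans (x∈p⇒∣p-x∣<∣p∣ v∈W) ∣W∣≤c)) (Pr≤q v)
                    (λ w w∈W′ → v-min w (p─q⊆p W ⁅ v ⁆ w∈W′)) Pr≤q

    sampling-lemma : ∀ {q} → 0ℚ ≤ q → (∀ v → Pr∈ D v ≤ q) → (1ℚ - q) * F P ≤ 𝔼 D (λ T → F (P ∪ T))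
    sampling-lemma {q} 0≤q Pr≤q = begin
      (1ℚ - q) * F P                       ≡⟨ trans (cong ((1ℚ - q) * F P +_) (*-zeroˡ (F (P ∪ ⊤)))) (+-identityʳ _) ⟨
      (1ℚ - q) * F P + 0ℚ * F (P ∪ ⊤)      ≤⟨ sampling-bound m ⊤ (∣p∣≤n ⊤) 0≤q 0≤Pr Pr≤q ⟩
      𝔼 D (λ T → F (P ∪ T ∩ ⊤))            ≡⟨ 𝔼-cong D (λ T _ → cong (λ Z → F (P ∪ Z)) (∩-identityʳ T)) ⟩
      𝔼 D (λ T → F (P ∪ T))                ∎
      where
      open ℚ.≤-Reasoning
      0≤Pr : ∀ v → v ∈ ⊤ → 0ℚ ≤ Pr∈ D v
      0≤Pr v _ = 𝔼-nonNeg 0≤D (λ T _ → 𝟙-nonNeg (v ∈? T))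

module DerandomizedGreedy (n k : ℕ) (f₀ : Subset n → ℚ) (I₀ : Subset n → Set) where

  open Alg n k f₀ I₀

  decay : ℚ
  decay = 1ℚ - (κ + κ)

  module _ (D : Dist N) (M : Subset N) (g : Subset N → Fin N → Fin N) (x : Fin N → Subset N → ℚ) where

    chosen? : ∀ S u → Dec (u ∈ M × 0ℚ <ℚ x u S)
    chosen? S u = (u ∈? M) ×-dec (0ℚ <? x u S)

    ∈-nextDist⁻ : ∀ {w} → w ∈ˡ nextDist D M g x →
                  ∃ λ S → ∃ λ u → S ∈ˡ supp D × u ∈ M × 0ℚ <ℚ x u S ×
                                  w ≡ (x u S * PrSet D S , S ∪ ⁅ u ⁆ ─ ⁅ g S u ⁆)
    ∈-nextDist⁻ w∈ with find (∈-concatMap⁻ (λ S → map (λ u → (x u S * PrSet D S , S ∪ ⁅ u ⁆ ─ ⁅ g S u ⁆))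
                                                  (filter (chosen? S) (allFin N))) {xs = supp D} w∈)
    ... | S , S∈ , w∈S with ∈-map⁻ (λ u → (x u S * PrSet D S , S ∪ ⁅ u ⁆ ─ ⁅ g S u ⁆)) w∈S
    ...   | u , u∈ , refl with ∈-filter⁻ (chosen? S) {xs = allFin N} u∈
    ...     | _ , u∈M , 0<x = S , u , S∈ , u∈M , 0<x , refl

    nextDist-nonNeg : NonNegWeights D → NonNegWeights (nextDist D M g x)
    nextDist-nonNeg 0≤D = All.tabulate λ w∈ → weight≥0 (∈-nextDist⁻ w∈)
      where
      weight≥0 : ∀ {w} → (∃ λ S → ∃ λ u → S ∈ˡ supp D × u ∈ M × 0ℚ <ℚ x u S ×
                                        w ≡ (x u S * PrSet D S , S ∪ ⁅ u ⁆ ─ ⁅ g S u ⁆)) →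
                 0ℚ ≤ proj₁ w
      weight≥0 (S , u , _ , _ , 0<x , refl) = *-nonNeg (ℚ.<⇒≤ 0<x) (PrSet-nonNeg 0≤D S)

    InSupp-nextDist : ∀ {S′} → InSupp (nextDist D M g x) S′ →
                      ∃ λ S → ∃ λ u → InSupp D S × u ∈ M × S′ ≡ S ∪ ⁅ u ⁆ ─ ⁅ g S u ⁆
    InSupp-nextDist S′∈ with find S′∈
    ... | w , w∈ , refl with ∈-nextDist⁻ w∈
    ...   | S , u , S∈ , u∈M , _ , refl = S , u , ∈supp⇒InSupp D S∈ , u∈M , refl

    𝔼-nextDist : (∀ u S → u ∈ M → InSupp D S → 0ℚ ≤ x u S) → ∀ ψ →
                 𝔼 (nextDist D M g x) ψ ≡ 𝔼 D (λ S → ΣIn M (λ u → x u S * ψ (S ∪ ⁅ u ⁆ ─ ⁅ g S u ⁆)))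
    𝔼-nextDist 0≤x ψ = begin
      𝔼 (nextDist D M g x) ψ
        ≡⟨ ∑-concatMap (λ S → map (pair S) (filter (chosen? S) (allFin N))) (supp D) _ ⟩
      ∑ (supp D) (λ S → ∑ (map (pair S) (filter (chosen? S) (allFin N))) (λ w → proj₁ w * ψ (proj₂ w)))
        ≡⟨ ∑-cong (supp D) (λ S S∈ → per-set S (∈supp⇒InSupp D S∈)) ⟩
      ∑ (supp D) (λ S → PrSet D S * ΣIn M (λ u → x u S * ψ (S ∪ ⁅ u ⁆ ─ ⁅ g S u ⁆)))
        ≡⟨ 𝔼-by-supp D _ ⟩
      𝔼 D (λ S → ΣIn M (λ u → x u S * ψ (S ∪ ⁅ u ⁆ ─ ⁅ g S u ⁆)))
        ∎
      where
      open ≡-Reasoning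
      pair : Subset N → Fin N → ℚ × Subset N
      pair S u = (x u S * PrSet D S , S ∪ ⁅ u ⁆ ─ ⁅ g S u ⁆)
      per-set : ∀ S → InSupp D S → ∑ (map (pair S) (filter (chosen? S) (allFin N))) (λ w → proj₁ w * ψ (proj₂ w))
                                   ≡ PrSet D S * ΣIn M (λ u → x u S * ψ (S ∪ ⁅ u ⁆ ─ ⁅ g S u ⁆))
      per-set S S∈ = begin
        ∑ (map (pair S) (filter (chosen? S) (allFin N))) (λ w → proj₁ w * ψ (proj₂ w))
          ≡⟨ ∑-map (pair S) (filter (chosen? S) (allFin N)) _ ⟩
        ∑ (filter (chosen? S) (allFin N)) (λ u → x u S * PrSet D S * ψ (S′ u))
          ≡⟨ ∑-filter (chosen? S) (allFin N) _ ⟩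
        ∑ (allFin N) (λ u → 𝟙 (chosen? S u) * (x u S * PrSet D S * ψ (S′ u)))
          ≡⟨ ∑-cong (allFin N) (λ u _ → pointwise u) ⟩
        ∑ (allFin N) (λ u → PrSet D S * (𝟙 (u ∈? M) * (x u S * ψ (S′ u))))
          ≡⟨ ∑-*ˡ (allFin N) (PrSet D S) _ ⟩
        PrSet D S * ∑ (allFin N) (λ u → 𝟙 (u ∈? M) * (x u S * ψ (S′ u)))
          ≡⟨ cong (PrSet D S *_) (∑-filter (_∈? M) (allFin N) _) ⟨
        PrSet D S * ΣIn M (λ u → x u S * ψ (S′ u))
          ∎
        where
        S′ : Fin N → Subset N
        S′ u = S ∪ ⁅ u ⁆ ─ ⁅ g S u ⁆
        -- nextDist drops the pairs with x(u,S) = 0; they contribute nothing anyway.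
        pointwise : ∀ u → 𝟙 (chosen? S u) * (x u S * PrSet D S * ψ (S′ u))
                        ≡ PrSet D S * (𝟙 (u ∈? M) * (x u S * ψ (S′ u)))
        pointwise u = drop-zero-weight (u ∈? M) (0ℚ <? x u S) (x u S) (PrSet D S) (ψ (S′ u))
          (λ u∈M x≯0 → ℚ.≤-antisym (ℚ.≮⇒≥ x≯0) (0≤x u S u∈M S∈))

  f-submodular : Submodular f₀ → Submodular f
  f-submodular f₀-sub X Y = subst₂ (λ U V → f₀ U + f₀ V ≤ f X + f Y)
    (sym (take-zipWith _∨_ X Y)) (sym (take-zipWith _∧_ X Y)) (f₀-sub (take n X) (take n Y))

  -- Otherwise some dummy is missing from M and could be added to it.
  k≤∣Base∣ : ∀ {M} → Base M → k ℕ.≤ ∣ M ∣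
  k≤∣Base∣ {M} (M∈I , M-maximal) with k ℕ.≤? ∣ M ∣
  ... | yes k≤∣M∣ = k≤∣M∣
  ... | no  k≰∣M∣ = ⊥-elim (M-maximal d d∉M (M∪d∈I₀ , ∣M∪d∣≤k))
    where
    ∣M∣<k : ∣ M ∣ ℕ.< k
    ∣M∣<k = ℕ.≰⇒> k≰∣M∣
    ∣drop∣<k+k : ∣ drop n M ∣ ℕ.< k ℕ.+ k
    ∣drop∣<k+k = begin-strict
      ∣ drop n M ∣                    ≤⟨ ℕ.m≤n+m _ _ ⟩
      ∣ take n M ∣ ℕ.+ ∣ drop n M ∣   ≡⟨ ∣++∣ (take n M) (drop n M) ⟨
      ∣ take n M ++ᵥ drop n M ∣ ≡⟨ cong ∣_∣ (take++drop≡id n M) ⟩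
      ∣ M ∣                           <⟨ ∣M∣<k ⟩
      k                               ≤⟨ ℕ.m≤m+n k k ⟩
      k ℕ.+ k                         ∎
      where open ℕ.≤-Reasoning
    free-dummy : ∃ λ j → j ∉ drop n M
    free-dummy = ∃∉ {X = drop n M} ∣drop∣<k+k
    j : Fin (k ℕ.+ k)
    j = proj₁ free-dummy
    d : Fin N
    d = n ↑ʳ j
    d∉M : d ∉ M
    d∉M = lookup⇒∉ (trans (sym (lookup-drop n M j)) (∉⇒lookup (proj₂ free-dummy)))
    M∪d∈I₀ : I₀ (take n (M ∪ ⁅ d ⁆))
    M∪d∈I₀ = subst I₀ (sym (trans (take-zipWith _∨_ M ⁅ d ⁆)
                              (trans (cong (take n M ∪_) (take-⁅↑ʳ⁆ n j)) (∪-identityʳ (take n M)))))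
                      (proj₁ M∈I)
    ∣M∪d∣≤k : ∣ M ∪ ⁅ d ⁆ ∣ ℕ.≤ k
    ∣M∪d∣≤k = subst (ℕ._≤ k) (sym (trans (cong ∣_∣ (∪-comm M ⁅ d ⁆)) (∣⁅x⁆∪p∣≡1+∣p∣ d M d∉M))) ∣M∣<k

  base-extending : ∀ {O} → I₀ O → ∣ O ∣ ℕ.≤ k → ∃ λ B → Base B × take n B ≡ O
  base-extending {O} O∈I₀ ∣O∣≤k = B , (B∈I , B-maximal) , take-++ O dummies
    where
    dummies-of-size : ∃ λ (X : Subset (k ℕ.+ k)) → ∣ X ∣ ≡ k ℕ.∸ ∣ O ∣
    dummies-of-size = subset-of-size {k ℕ.+ k} (ℕ.≤-trans (ℕ.m∸n≤m k ∣ O ∣) (ℕ.m≤m+n k k))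
    dummies : Subset (k ℕ.+ k)
    dummies = proj₁ dummies-of-size
    B : Subset N
    B = O ++ᵥ dummies
    ∣B∣≡k : ∣ B ∣ ≡ k
    ∣B∣≡k = trans (∣++∣ O dummies) (trans (cong (∣ O ∣ ℕ.+_) (proj₂ dummies-of-size)) (ℕ.m+[n∸m]≡n ∣O∣≤k))
    B∈I : I B
    B∈I = subst I₀ (sym (take-++ O dummies)) O∈I₀ , ℕ.≤-reflexive ∣B∣≡k
    B-maximal : ∀ y → y ∉ B → ¬ I (B ∪ ⁅ y ⁆)
    B-maximal y y∉B (_ , ∣B∪y∣≤k) = ℕ.<-irrefl refl (ℕ.≤-trans (ℕ.≤-reflexive (cong suc (sym ∣B∣≡k)))
      (subst (ℕ._≤ k) (trans (cong ∣_∣ (∪-comm B ⁅ y ⁆)) (∣⁅x⁆∪p∣≡1+∣p∣ y B y∉B)) ∣B∪y∣≤k))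

  module Iteration {D : Dist N} {M : Subset N} {g : Subset N → Fin N → Fin N} {x : Fin N → Subset N → ℚ}
    (0≤D : NonNegWeights D) (mass : 𝔼 D (λ _ → 1ℚ) ≡ 1ℚ) (D⊆I : ∀ S → InSupp D S → I S)
    (M-maxBase : MaxBase D M) (g-exchange : ∀ S → InSupp D S → Exchange M S (g S))
    (x-gain≥ : κ * ΣIn M (λ u → 𝔼 D (marg u)) ≤ ΣIn M (λ u → 𝔼 D (λ S → x u S * marg u S)))
    (x-loss≤ : ΣIn M (λ u → 𝔼 D (λ S → x u S * margOut (g S u) S))
                 ≤ κ * ΣIn M (λ u → 𝔼 D (λ S → margOut (g S u) S)))
    (x-insert≤ : ∀ u → u ∈ M →
                 𝔼 D (λ S → x u S * 𝟙 (¬? (u ∈? S))) ≤ κ * 𝔼 D (λ S → 𝟙 (¬? (u ∈? S))))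
    (x-remove≥ : ∀ u → κ * 𝔼 D (λ S → 𝟙 (u ∈? S)) ≤ 𝔼 D (λ S → xInv M g x u S * 𝟙 (u ∈? S)))
    (x-sum≡1 : ∀ S → InSupp D S → ΣIn M (λ u → x u S) ≡ 1ℚ)
    (0≤x : ∀ u S → u ∈ M → InSupp D S → 0ℚ ≤ x u S) where

    D′ : Dist N
    D′ = nextDist D M g x

    S′ : Fin N → Subset N → Subset N
    S′ u S = S ∪ ⁅ u ⁆ ─ ⁅ g S u ⁆

    D′-nonNeg : NonNegWeights D′
    D′-nonNeg = nextDist-nonNeg D M g x 0≤D

    D′-mass : 𝔼 D′ (λ _ → 1ℚ) ≡ 1ℚ
    D′-mass = begin
      𝔼 D′ (λ _ → 1ℚ)
        ≡⟨ 𝔼-nextDist D M g x 0≤x (λ _ → 1ℚ) ⟩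
      𝔼 D (λ S → ΣIn M (λ u → x u S * 1ℚ))
        ≡⟨ 𝔼-cong D (λ S S∈ → trans (∑-cong (elements M) (λ u _ → *-identityʳ (x u S))) (x-sum≡1 S S∈)) ⟩
      𝔼 D (λ _ → 1ℚ)
        ≡⟨ mass ⟩
      1ℚ
        ∎
      where open ≡-Reasoning

    D′⊆I : ∀ S → InSupp D′ S → I S
    D′⊆I _ S∈ with InSupp-nextDist D M g x S∈
    ... | S , u , S∈D , u∈M , refl = proj₂ (proj₂ (proj₂ (g-exchange S S∈D))) u u∈M

    Pr∉ : ∀ v → 𝔼 D (λ S → 𝟙 (¬? (v ∈? S))) ≡ 1ℚ - Pr∈ D v
    Pr∉ v = begin
      𝔼 D (λ S → 𝟙 (¬? (v ∈? S)))         ≡⟨ 𝔼-cong D (λ S _ → 𝟙-¬ (v ∈? S)) ⟩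
      𝔼 D (λ S → 1ℚ - 𝟙 (v ∈? S))         ≡⟨ 𝔼-- D _ _ ⟩
      𝔼 D (λ _ → 1ℚ) - Pr∈ D v            ≡⟨ cong (_- Pr∈ D v) mass ⟩
      1ℚ - Pr∈ D v                        ∎
      where open ≡-Reasoning

    x-on-M : Fin N → Subset N → ℚ
    x-on-M v S = ΣIn M (λ u → 𝟙 (v Fin.≟ u) * x u S)

    membership-after-swap : ∀ v S u → u ∈ M → InSupp D S →
      x u S * 𝟙 (v ∈? S′ u S)
        ≤ 𝟙 (v ∈? S) * (x u S - 𝟙 (g S u Fin.≟ v) * x u S) + 𝟙 (¬? (v ∈? S)) * (𝟙 (v Fin.≟ u) * x u S)
    membership-after-swap v S u u∈M S∈ = begin
      x u S * ι (does (v ∈? S′ u S))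
        ≡⟨ cong (λ b → x u S * ι b) (trans (does-∈? v (S′ u S)) (lookup-⟦⟧ (var S ∪ₑ ⁅ u ⁆ₑ ─ₑ ⁅ g S u ⁆ₑ) v)) ⟩
      x u S * ι ((lookup S v ∨ does (u Fin.≟ v)) ∧ not (does (g S u Fin.≟ v)))
        ≤⟨ bool-bound (lookup S v) (does (u Fin.≟ v)) (does (g S u Fin.≟ v)) (0≤x u S u∈M S∈) ⟩
      ι (lookup S v) * (x u S - ι (does (g S u Fin.≟ v)) * x u S) + ι (not (lookup S v)) * (ι (does (u Fin.≟ v)) * x u S)
        ≡⟨ cong₂ (λ s a → ι s * (x u S - ι (does (g S u Fin.≟ v)) * x u S) + ι (not s) * (ι a * x u S))
                 (sym (does-∈? v S)) (does-≟-sym u v) ⟩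
      ι (does (v ∈? S)) * (x u S - ι (does (g S u Fin.≟ v)) * x u S) + ι (not (does (v ∈? S))) * (ι (does (v Fin.≟ u)) * x u S)
        ∎
      where
      open ℚ.≤-Reasoning
      bool-bound : ∀ s a b {X} → 0ℚ ≤ X → X * ι ((s ∨ a) ∧ not b) ≤ ι s * (X - ι b * X) + ι (not s) * (ι a * X)
      bool-bound true  a     true  {X} _   = ≤-reflexive
        (solve 1 (λ X → X :* con 0ℚ := con 1ℚ :* (X :- con 1ℚ :* X) :+ con 0ℚ :* (con (ι a) :* X)) refl X)
      bool-bound true  a     false {X} _   = ≤-reflexive
        (solve 1 (λ X → X :* con 1ℚ := con 1ℚ :* (X :- con 0ℚ :* X) :+ con 0ℚ :* (con (ι a) :* X)) refl X)
      bool-bound false false b     {X} _   = ≤-reflexive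
        (solve 1 (λ X → X :* con 0ℚ := con 0ℚ :* (X :- con (ι b) :* X) :+ con 1ℚ :* (con 0ℚ :* X)) refl X)
      bool-bound false true  true  {X} 0≤X = ≤-by-slack 0≤X
        (solve 1 (λ X → X :* con 0ℚ :+ (X :- con 0ℚ) := con 0ℚ :* (X :- con 1ℚ :* X) :+ con 1ℚ :* (con 1ℚ :* X)) refl X)
      bool-bound false true  false {X} _   = ≤-reflexive
        (solve 1 (λ X → X :* con 1ℚ := con 0ℚ :* (X :- con 0ℚ :* X) :+ con 1ℚ :* (con 1ℚ :* X)) refl X)

    membership-after-step : ∀ v S → InSupp D S →
      ΣIn M (λ u → x u S * 𝟙 (v ∈? S′ u S))
        ≤ 𝟙 (v ∈? S) - xInv M g x v S * 𝟙 (v ∈? S) + 𝟙 (¬? (v ∈? S)) * x-on-M v S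
    membership-after-step v S S∈ = begin
      ΣIn M (λ u → x u S * 𝟙 (v ∈? S′ u S))
        ≤⟨ ∑-mono (elements M) (λ u u∈ → membership-after-swap v S u (∈-elements⁻ u∈) S∈) ⟩
      ΣIn M (λ u → s * (x u S - 𝟙 (g S u Fin.≟ v) * x u S) + s̄ * (𝟙 (v Fin.≟ u) * x u S))
        ≡⟨ ∑-+ (elements M) _ _ ⟩
      ΣIn M (λ u → s * (x u S - 𝟙 (g S u Fin.≟ v) * x u S)) + ΣIn M (λ u → s̄ * (𝟙 (v Fin.≟ u) * x u S))
        ≡⟨ cong₂ _+_ (∑-*ˡ (elements M) s _) (∑-*ˡ (elements M) s̄ _) ⟩
      s * ΣIn M (λ u → x u S - 𝟙 (g S u Fin.≟ v) * x u S) + s̄ * x-on-M v S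
        ≡⟨ cong (λ z → s * z + s̄ * x-on-M v S) (trans (∑-- (elements M) _ _) (cong (_- xInv M g x v S) (x-sum≡1 S S∈))) ⟩
      s * (1ℚ - xInv M g x v S) + s̄ * x-on-M v S
        ≡⟨ solve 3 (λ a b c → a :* (con 1ℚ :- b) :+ c := a :- b :* a :+ c) refl s (xInv M g x v S) (s̄ * x-on-M v S) ⟩
      s - xInv M g x v S * s + s̄ * x-on-M v S
        ∎
      where
      open ℚ.≤-Reasoning
      s s̄ : ℚ
      s = 𝟙 (v ∈? S)
      s̄ = 𝟙 (¬? (v ∈? S))

    entering-mass≤ : ∀ v → 𝔼 D (λ S → 𝟙 (¬? (v ∈? S)) * x-on-M v S) ≤ κ * (1ℚ - Pr∈ D v)
    entering-mass≤ v with v ∈? M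
    ... | yes v∈M = begin
      𝔼 D (λ S → 𝟙 (¬? (v ∈? S)) * x-on-M v S)  ≡⟨ 𝔼-cong D (λ S _ → trans (cong (𝟙 (¬? (v ∈? S)) *_) (x-on-M≡x S))
                                                                        (*-comm (𝟙 (¬? (v ∈? S))) (x v S))) ⟩
      𝔼 D (λ S → x v S * 𝟙 (¬? (v ∈? S)))      ≤⟨ x-insert≤ v v∈M ⟩
      κ * 𝔼 D (λ S → 𝟙 (¬? (v ∈? S)))          ≡⟨ cong (κ *_) (Pr∉ v) ⟩
      κ * (1ℚ - Pr∈ D v)                        ∎
      where
      open ℚ.≤-Reasoning
      x-on-M≡x : ∀ S → x-on-M v S ≡ x v S
      x-on-M≡x S = ∑-𝟙≟ Fin._≟_ (λ u → x u S) (elements-unique M) (∈-elements⁺ v∈M)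
    ... | no v∉M = begin
      𝔼 D (λ S → 𝟙 (¬? (v ∈? S)) * x-on-M v S)  ≡⟨ 𝔼-cong D (λ S _ → trans (cong (𝟙 (¬? (v ∈? S)) *_) (x-on-M≡0 S))
                                                                        (*-zeroʳ (𝟙 (¬? (v ∈? S))))) ⟩
      𝔼 D (λ _ → 0ℚ)                           ≡⟨ 𝔼-const {D = D} 0ℚ mass ⟩
      0ℚ                                       ≤⟨ *-nonNeg (0≤recip k) (𝔼-nonNeg 0≤D (λ S _ → 𝟙-nonNeg (¬? (v ∈? S)))) ⟩
      κ * 𝔼 D (λ S → 𝟙 (¬? (v ∈? S)))          ≡⟨ cong (κ *_) (Pr∉ v) ⟩
      κ * (1ℚ - Pr∈ D v)                        ∎
      where
      open ℚ.≤-Reasoning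
      x-on-M≡0 : ∀ S → x-on-M v S ≡ 0ℚ
      x-on-M≡0 S = ∑-zero (elements M) off
        where
        off : ∀ u → u ∈ˡ elements M → 𝟙 (v Fin.≟ u) * x u S ≡ 0ℚ
        off u u∈ with v Fin.≟ u
        ... | yes refl = ⊥-elim (v∉M (∈-elements⁻ u∈))
        ... | no _     = *-zeroˡ (x u S)

    Pr∈-next : ∀ v → Pr∈ D′ v ≤ decay * Pr∈ D v + κ
    Pr∈-next v = begin
      Pr∈ D′ v
        ≡⟨ 𝔼-nextDist D M g x 0≤x (λ S → 𝟙 (v ∈? S)) ⟩
      𝔼 D (λ S → ΣIn M (λ u → x u S * 𝟙 (v ∈? S′ u S)))
        ≤⟨ 𝔼-mono 0≤D (membership-after-step v) ⟩
      𝔼 D (λ S → 𝟙 (v ∈? S) - xInv M g x v S * 𝟙 (v ∈? S) + 𝟙 (¬? (v ∈? S)) * x-on-M v S)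
        ≡⟨ trans (𝔼-+ D _ _) (cong (_+ 𝔼 D (λ S → 𝟙 (¬? (v ∈? S)) * x-on-M v S)) (𝔼-- D _ _)) ⟩
      Pr∈ D v - 𝔼 D (λ S → xInv M g x v S * 𝟙 (v ∈? S)) + 𝔼 D (λ S → 𝟙 (¬? (v ∈? S)) * x-on-M v S)
        ≤⟨ +-mono-≤ (+-monoʳ-≤ (Pr∈ D v) (neg-antimono-≤ (x-remove≥ v))) (entering-mass≤ v) ⟩
      Pr∈ D v - κ * Pr∈ D v + κ * (1ℚ - Pr∈ D v)
        ≡⟨ solve 2 (λ p κ → p :- κ :* p :+ κ :* (con 1ℚ :- p) := (con 1ℚ :- (κ :+ κ)) :* p :+ κ) refl (Pr∈ D v) κ ⟩
      decay * Pr∈ D v + κ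
        ∎
      where open ℚ.≤-Reasoning

    module _ (f₀≥0 : NonNegative f₀) (f₀-sub : Submodular f₀)
             {O : Subset n} (O∈I₀ : I₀ O) (∣O∣≤k : ∣ O ∣ ℕ.≤ k) where

      open Submodularity f (f-submodular f₀-sub)

      Gain Loss : ℚ
      Gain = ΣIn M (λ u → 𝔼 D (λ S → x u S * marg u S))
      Loss = ΣIn M (λ u → 𝔼 D (λ S → x u S * margOut (g S u) S))

      value-after-swaps : ∀ S → InSupp D S →
        f S + ΣIn M (λ u → x u S * marg u S) - ΣIn M (λ u → x u S * margOut (g S u) S)
          ≤ ΣIn M (λ u → x u S * f (S′ u S))
      value-after-swaps S S∈ = begin
        f S + ΣIn M (λ u → x u S * marg u S) - ΣIn M (λ u → x u S * margOut (g S u) S)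
          ≡⟨ cong (λ z → z + ΣIn M (λ u → x u S * marg u S) - ΣIn M (λ u → x u S * margOut (g S u) S)) weights-sum ⟨
        ΣIn M (λ u → x u S * f S) + ΣIn M (λ u → x u S * marg u S) - ΣIn M (λ u → x u S * margOut (g S u) S)
          ≡⟨ trans (∑-- (elements M) _ _) (cong (_- ΣIn M (λ u → x u S * margOut (g S u) S)) (∑-+ (elements M) _ _)) ⟨
        ΣIn M (λ u → x u S * f S + x u S * marg u S - x u S * margOut (g S u) S)
          ≡⟨ ∑-cong (elements M) (λ u _ → factor (x u S) (f S) (marg u S) (margOut (g S u) S)) ⟩
        ΣIn M (λ u → x u S * (f S + marg u S - margOut (g S u) S))
          ≤⟨ ∑-mono (elements M) (λ u u∈ → *-monoˡ-≤-≥0 (0≤x u S (∈-elements⁻ u∈) S∈)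
                                            (exchange-≤ u (proj₁ (g-exchange S S∈) u (∈-elements⁻ u∈)))) ⟩
        ΣIn M (λ u → x u S * f (S′ u S))
          ∎
        where
        open ℚ.≤-Reasoning
        weights-sum : ΣIn M (λ u → x u S * f S) ≡ f S
        weights-sum = trans (∑-*ʳ (elements M) (f S) (λ u → x u S))
                            (trans (cong (_* f S) (x-sum≡1 S S∈)) (*-identityˡ (f S)))
        factor : ∀ a b c d → a * b + a * c - a * d ≡ a * (b + c - d)
        factor = solve 4 (λ a b c d → a :* b :+ a :* c :- a :* d := a :* (b :+ c :- d)) refl

      value-after-step : 𝔼 D f + Gain - Loss ≤ 𝔼 D′ f
      value-after-step = begin
        𝔼 D f + Gain - Loss
          ≡⟨ cong₂ (λ a b → 𝔼 D f + a - b) (𝔼-∑ D (elements M) (λ u S → x u S * marg u S))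
                                           (𝔼-∑ D (elements M) (λ u S → x u S * margOut (g S u) S)) ⟨
        𝔼 D f + 𝔼 D (λ S → ΣIn M (λ u → x u S * marg u S)) - 𝔼 D (λ S → ΣIn M (λ u → x u S * margOut (g S u) S))
          ≡⟨ trans (𝔼-- D _ _) (cong (_- 𝔼 D (λ S → ΣIn M (λ u → x u S * margOut (g S u) S))) (𝔼-+ D _ _)) ⟨
        𝔼 D (λ S → f S + ΣIn M (λ u → x u S * marg u S) - ΣIn M (λ u → x u S * margOut (g S u) S))
          ≤⟨ 𝔼-mono 0≤D value-after-swaps ⟩
        𝔼 D (λ S → ΣIn M (λ u → x u S * f (S′ u S)))
          ≡⟨ 𝔼-nextDist D M g x 0≤x f ⟨
        𝔼 D′ f
          ∎
        where open ℚ.≤-Reasoning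

      -- g_S maps M injectively into S, and |S| ≤ k ≤ |M|, so g_S(M) = S.
      removal-marginals≤ : ∀ S → InSupp D S → ΣIn M (λ u → margOut (g S u) S) ≤ f S
      removal-marginals≤ S S∈ = begin
        ΣIn M (λ u → margOut (g S u) S)
          ≡⟨ ∑-map (g S) (elements M) (λ v → f S - f (S ─ ⁅ v ⁆)) ⟨
        ∑ image (λ v → f S - f (S ─ ⁅ v ⁆))
          ≤⟨ ∑-removal-marginals-≤ S image-unique image⊆S ⟩
        f (fromList image) - f ⊥
          ≡⟨ cong (λ T → f T - f ⊥) image≡S ⟩
        f S - f ⊥
          ≤⟨ ≤-by-slack (f₀≥0 (take n ⊥)) (solve 2 (λ a b → a :- b :+ (b :- con 0ℚ) := a) refl (f S) (f ⊥)) ⟩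
        f S
          ∎
        where
        open ℚ.≤-Reasoning
        image : List (Fin N)
        image = map (g S) (elements M)
        g-injective : ∀ u v → u ∈ M → v ∈ M → g S u ≡ g S v → u ≡ v
        g-injective = proj₁ (proj₂ (g-exchange S S∈))
        image-unique : Unique image
        image-unique = unique-map (g S) (elements-unique M)
          (λ u∈ v∈ → g-injective _ _ (∈-elements⁻ u∈) (∈-elements⁻ v∈))
        image⊆S : fromList image ⊆ S
        image⊆S v∈ with ∈-map⁻ (g S) (∈-fromList⁻ image v∈)
        ... | u , u∈ , refl = proj₁ (g-exchange S S∈) u (∈-elements⁻ u∈)
        ∣M∣≡∣image∣ : ∣ M ∣ ≡ ∣ fromList image ∣
        ∣M∣≡∣image∣ = trans (∣∣≡length-elements M)
          (trans (sym (length-map (g S) (elements M))) (sym (∣fromList∣ image-unique)))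
        ∣S∣≤∣image∣ : ∣ S ∣ ℕ.≤ ∣ fromList image ∣
        ∣S∣≤∣image∣ =
          ℕ.≤-trans (proj₂ (D⊆I S S∈)) (ℕ.≤-trans (k≤∣Base∣ (proj₁ M-maxBase)) (ℕ.≤-reflexive ∣M∣≡∣image∣))
        image≡S : fromList image ≡ S
        image≡S = ⊆∧∣⊇∣⇒≡ image⊆S ∣S∣≤∣image∣

      total-removal≤ : ΣIn M (λ u → 𝔼 D (λ S → margOut (g S u) S)) ≤ 𝔼 D f
      total-removal≤ = ≤-trans (≤-reflexive (sym (𝔼-∑ D (elements M) (λ u S → margOut (g S u) S))))
                               (𝔼-mono 0≤D removal-marginals≤)

      module _ {q} (0≤q : 0ℚ ≤ q) (Pr≤q : ∀ (w : Fin n) → Pr∈ D (w ↑ˡ (k ℕ.+ k)) ≤ q) where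

        B : Subset N
        B = proj₁ (base-extending O∈I₀ ∣O∣≤k)

        B-base : Base B
        B-base = proj₁ (proj₂ (base-extending O∈I₀ ∣O∣≤k))

        take-B : take n B ≡ O
        take-B = proj₂ (proj₂ (base-extending O∈I₀ ∣O∣≤k))

        D₀ : Dist n
        D₀ = map (map₂ (take n)) D

        𝔼-D₀ : ∀ (φ : Subset n → ℚ) → 𝔼 D₀ φ ≡ 𝔼 D (λ S → φ (take n S))
        𝔼-D₀ φ = ∑-map (map₂ (take n)) D _

        Pr∈-D₀≤q : ∀ w → Pr∈ D₀ w ≤ q
        Pr∈-D₀≤q w = ≤-trans (≤-reflexive (trans (𝔼-D₀ _) (𝔼-cong D (λ S _ → cong ι same-membership)))) (Pr≤q w)
          where
          same-membership : ∀ {S} → does (w ∈? take n S) ≡ does (w ↑ˡ (k ℕ.+ k) ∈? S)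
          same-membership {S} = trans (does-∈? w (take n S)) (trans (lookup-take n S w) (sym (does-∈? (w ↑ˡ (k ℕ.+ k)) S)))

        open Submodularity.Sampling f₀ f₀-sub f₀≥0 {D₀} (All.map⁺ 0≤D) (trans (𝔼-D₀ (λ _ → 1ℚ)) mass) O
          using (sampling-lemma)

        value-with-B≥ : (1ℚ - q) * f₀ O ≤ 𝔼 D (λ S → f (S ∪ B))
        value-with-B≥ = begin
          (1ℚ - q) * f₀ O                     ≤⟨ sampling-lemma 0≤q Pr∈-D₀≤q ⟩
          𝔼 D₀ (λ T → f₀ (O ∪ T))             ≡⟨ 𝔼-D₀ _ ⟩
          𝔼 D (λ S → f₀ (O ∪ take n S))       ≡⟨ 𝔼-cong D (λ S _ → cong f₀ (take-∪B S)) ⟩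
          𝔼 D (λ S → f (S ∪ B))               ∎
          where
          open ℚ.≤-Reasoning
          take-∪B : ∀ S → O ∪ take n S ≡ take n (S ∪ B)
          take-∪B S = trans (∪-comm O (take n S)) (trans (cong (take n S ∪_) (sym take-B)) (sym (take-zipWith _∨_ S B)))

        total-marginals≥ : (1ℚ - q) * f₀ O - 𝔼 D f ≤ ΣIn M (λ u → 𝔼 D (marg u))
        total-marginals≥ = begin
          (1ℚ - q) * f₀ O - 𝔼 D f                ≤⟨ +-monoˡ-≤ (- 𝔼 D f) value-with-B≥ ⟩
          𝔼 D (λ S → f (S ∪ B)) - 𝔼 D f          ≡⟨ 𝔼-- D _ _ ⟨
          𝔼 D (λ S → f (S ∪ B) - f S)            ≤⟨ 𝔼-mono 0≤D (λ S _ → ΣIn-marginals-≥ S B) ⟩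
          𝔼 D (λ S → ΣIn B (λ u → marg u S))     ≡⟨ 𝔼-∑ D (elements B) (λ u S → marg u S) ⟩
          ΣIn B (λ u → 𝔼 D (marg u))             ≤⟨ proj₂ M-maxBase B B-base ⟩
          ΣIn M (λ u → 𝔼 D (marg u))             ∎
          where open ℚ.≤-Reasoning

        value-next : decay * 𝔼 D f + (κ * (1ℚ - q)) * f₀ O ≤ 𝔼 D′ f
        value-next = begin
          decay * 𝔼 D f + (κ * (1ℚ - q)) * f₀ O
            ≡⟨ solve 4 (λ κ e q o → (con 1ℚ :- (κ :+ κ)) :* e :+ (κ :* (con 1ℚ :- q)) :* o
                                  := e :+ κ :* ((con 1ℚ :- q) :* o :- e) :- κ :* e) refl κ (𝔼 D f) q (f₀ O) ⟩
          𝔼 D f + κ * ((1ℚ - q) * f₀ O - 𝔼 D f) - κ * 𝔼 D f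
            ≤⟨ +-mono-≤ (+-monoʳ-≤ (𝔼 D f) (≤-trans (*-monoˡ-≤-≥0 (0≤recip k) total-marginals≥) x-gain≥))
                        (neg-antimono-≤ (≤-trans x-loss≤ (*-monoˡ-≤-≥0 (0≤recip k) total-removal≤))) ⟩
          𝔼 D f + Gain - Loss
            ≤⟨ value-after-step ⟩
          𝔼 D′ f
            ∎
          where open ℚ.≤-Reasoning

  record Invariant (D : Dist N) (q : ℚ) : Set where
    field
      nonNeg : NonNegWeights D
      mass   : 𝔼 D (λ _ → 1ℚ) ≡ 1ℚ
      indep  : ∀ S → InSupp D S → I S
      Pr∈≤   : ∀ (w : Fin n) → Pr∈ D (w ↑ˡ (k ℕ.+ k)) ≤ q

  Step : Dist N → Dist N → Set
  Step D D′ = ∃ λ M → ∃ λ (g : Subset N → Fin N → Fin N) → ∃ λ (x : Fin N → Subset N → ℚ) →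
    MaxBase D M × (∀ S → InSupp D S → Exchange M S (g S)) × Extreme D M g x × D′ ≡ nextDist D M g x

  initial-invariant : ∀ {S₀} → Base S₀ → DummyOnly S₀ → Invariant ((1ℚ , S₀) ∷ []) 0ℚ
  initial-invariant {S₀} S₀-base S₀-dummy = record
    { nonNeg = 0≤1 ∷ []
    ; mass   = refl
    ; indep  = λ { _ (here refl) → proj₁ S₀-base }
    ; Pr∈≤   = λ w → ≤-reflexive (cong (λ b → 1ℚ * ι b + 0ℚ) (no-original w))
    }
    where
    no-original : ∀ w → does (w ↑ˡ (k ℕ.+ k) ∈? S₀) ≡ false
    no-original w = trans (does-∈? (w ↑ˡ (k ℕ.+ k)) S₀)
      (trans (sym (lookup-take n S₀ w)) (trans (cong (λ X → lookup X w) S₀-dummy) (lookup-replicate w false)))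

  invariant-step : ∀ {D D′ q} → 0ℚ ≤ decay → Invariant D q → Step D D′ → Invariant D′ (decay * q + κ)
  invariant-step 0≤decay inv
    (M , g , x , M-max , g-exch , ((gain≥ , loss≤ , insert≤ , remove≥ , sum≡1 , 0≤x) , _) , refl) = record
    { nonNeg = D′-nonNeg
    ; mass   = D′-mass
    ; indep  = D′⊆I
    ; Pr∈≤   = λ w → ≤-trans (Pr∈-next (w ↑ˡ (k ℕ.+ k))) (+-monoˡ-≤ κ (*-monoˡ-≤-≥0 0≤decay (Pr∈≤ w)))
    }
    where
    open Invariant inv
    open Iteration nonNeg mass indep M-max g-exch gain≥ loss≤ insert≤ remove≥ sum≡1 0≤x

  value-step : NonNegative f₀ → Submodular f₀ → ∀ {O} → I₀ O → ∣ O ∣ ℕ.≤ k →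
               ∀ {D D′ q} → 0ℚ ≤ q → Invariant D q → Step D D′ →
               decay * 𝔼 D f + (κ * (1ℚ - q)) * f₀ O ≤ 𝔼 D′ f
  value-step f₀≥0 f₀-sub O∈I₀ ∣O∣≤k 0≤q inv
    (M , g , x , M-max , g-exch , ((gain≥ , loss≤ , insert≤ , remove≥ , sum≡1 , 0≤x) , _) , refl) =
    value-next f₀≥0 f₀-sub O∈I₀ ∣O∣≤k 0≤q Pr∈≤
    where
    open Invariant inv
    open Iteration nonNeg mass indep M-max g-exch gain≥ loss≤ insert≤ remove≥ sum≡1 0≤x

  -- The bound q_j = (1 - decay^j)/2 on the probability of an original element solves q_{j+1} = decay q_j + 1/k.
  bound : ℕ → ℚ
  bound j = ½ * (1ℚ - decay ^ℚ j)

  bound-suc : ∀ j → bound (suc j) ≡ decay * bound j + κ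
  bound-suc j = solve 2 (λ κ t → con ½ :* (con 1ℚ :- (con 1ℚ :- (κ :+ κ)) :* t)
                              := (con 1ℚ :- (κ :+ κ)) :* (con ½ :* (con 1ℚ :- t)) :+ κ) refl κ (decay ^ℚ j)

  0≤bound : ∀ j → j ℕ.< k → 0ℚ ≤ bound j
  0≤bound zero    _     = ≤-refl
  0≤bound (suc j) 1+j<k = *-nonNeg {p = ½} (ℚ.<⇒≤ (positive⁻¹ ½))
    (p≤q⇒0≤q-p (^ℚ≤1 (0≤1-2/k (ℕ.≤-trans (s≤s (s≤s z≤n)) 1+j<k)) (1-2/k≤1 k) (suc j)))

  invariant : ∀ {D : ℕ → Dist N} → Run D → ∀ j → j ℕ.< k → Invariant (D j) (bound j)
  invariant ((_ , S₀-base , S₀-dummy , D₀≡) , _) zero _ =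
    subst (λ D₀ → Invariant D₀ 0ℚ) (sym D₀≡) (initial-invariant S₀-base S₀-dummy)
  invariant run@(_ , steps) (suc j) 1+j<k = subst (Invariant _) (sym (bound-suc j))
    (invariant-step (0≤1-2/k (ℕ.≤-trans (s≤s (s≤s z≤n)) 1+j<k)) (invariant run j j<k) (steps j j<k))
    where
    j<k : j ℕ.< k
    j<k = ℕ.<-trans (ℕ.n<1+n j) 1+j<k

lemma5 : (n k : ℕ) (f₀ : Subset n → ℚ) (M₀ : Matroid n) →
    NonNegative f₀ → Submodular f₀ → HasRank M₀ k →
    (O : Subset n) → Matroid.Indep M₀ O →
    (∀ S → Matroid.Indep M₀ S → f₀ S ≤ f₀ O) →
    (D : ℕ → Dist (Alg.N n k f₀ (Matroid.Indep M₀))) →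
    Alg.Run n k f₀ (Matroid.Indep M₀) D →
    ∀ j → j < k →
    (1ℚ - (recip k + recip k)) * 𝔼 (D j) (Alg.f n k f₀ (Matroid.Indep M₀))
    + ((1ℚ + ((1ℚ - (recip k + recip k)) ^ℚ j)) * recip (2 *ℕ k)) * f₀ O
    ≤ 𝔼 (D (suc j)) (Alg.f n k f₀ (Matroid.Indep M₀))
lemma5 n k f₀ M₀ f₀≥0 f₀-sub (_ , indep⇒≤k) O O∈I₀ _ D run j j<k = begin
  decay * 𝔼 (D j) f + ((1ℚ + decay ^ℚ j) * recip (2 *ℕ k)) * f₀ O
    ≡⟨ cong (λ c → decay * 𝔼 (D j) f + c * f₀ O) (halved-weight (ℕ.≤-trans (s≤s z≤n) j<k) (decay ^ℚ j)) ⟩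
  decay * 𝔼 (D j) f + (κ * (1ℚ - bound j)) * f₀ O
    ≤⟨ value-step f₀≥0 f₀-sub O∈I₀ (indep⇒≤k O O∈I₀) (0≤bound j j<k) (invariant run j j<k) (proj₂ run j j<k) ⟩
  𝔼 (D (suc j)) f
    ∎
  where
  open Alg n k f₀ (Matroid.Indep M₀)
  open DerandomizedGreedy n k f₀ (Matroid.Indep M₀)
  open ℚ.≤-Reasoning
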